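{- Let $q$ be a prime power, $r\ge 1$, and let $\tau$ be a permutation of the vectors of $F_q^r$ with $\tau({\bf 0})={\bf 0}$ and distension $l$. Then the rank (dimension of the $F_q$-linear span) of the code $S_\tau=\bigcup_{a\in F_q^r}C_a\times D_{\tau(a)}$ of length $\frac{q^{r+1}-1}{q-1}$ is equal to $\frac{q^{r+1}-1}{q-1}-r-1+l$.
   Context: Let $n=\frac{q^r-1}{q-1}$. Let $H_C$ be an $r\times n$ matrix over $F_q$ whose columns are representatives of the $n$ distinct one-dimensional subspaces of $F_q^r$, $C=\{x\in F_q^n: H_Cx^T={\bf 0}\}$, and for $a\in F_q^r$, $C_a=\{x\in F_q^n: H_Cx^T=a\}$. Let $D$ be the linear code of length $q^r$ with coordinate positions indexed by vectors of $F_q^r$, $D=\{y=(y_a)_{a\in F_q^r}: \sum_a y_a=0,\ \sum_a y_a a={\bf 0}\}$ (parity check matrix with column $\binom{1}{a}$ at position $a$). $e_a$ is the length-$q^r$ unit vector at position $a$, $D_a=D+e_{\bf 0}-e_a$, and $X\times Y=\{(x|y):x\in X, y\in Y\}$ with $|$ denoting concatenation. A permutation $\tau$ of $F_q^r$ acts on vectors of length $q^r$ by permuting positions, $\tau(e_a)=e_{\tau(a)}$ extended linearly; the distension of $\tau$ is $\dim D-\dim(D\cap\tau(D))$, where $\tau(D)=\{\tau(y):y\in D\}$. -}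

module Defs where

open import Level using (0ℓ)
open import Data.Nat using (ℕ; zero; suc)
open import Data.Fin using (Fin)
open import Data.Fin.Properties using (all?)
open import Data.Vec using (Vec; []; _∷_; zipWith; replicate; map)
open import Data.Vec.Properties using (≡-dec)
open import Data.List using (List; []; _∷_; concatMap; foldr)
import Data.List as L
open import Data.Sum using (_⊎_; inj₁; inj₂)
open import Data.Product using (Σ; ∃; _×_; _,_)
open import Relation.Binary.PropositionalEquality using (_≡_; _≢_)
open import Relation.Nullary using (¬_; Dec; yes; no)
open import Function.Bundles using (_↔_; Inverse)
open import Algebra.Structures using (IsCommutativeRing)
import Data.Fin.Properties as FinP

-- A finite field with q elements, its carrier represented as Fin q
-- (with propositional equality).  Every finite field is isomorphic to
-- one of these, and q is then necessarily a prime power; conversely for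
-- every prime power q such a structure exists.

record FiniteField (q : ℕ) : Set where
  infixl 7 _*_
  infixl 6 _+_
  field
    _+_ _*_ : Fin q → Fin q → Fin q
    -_      : Fin q → Fin q
    0# 1#   : Fin q
    isCommutativeRing : IsCommutativeRing _≡_ _+_ _*_ -_ 0# 1#
    0≢1     : 0# ≢ 1#
    inverse : ∀ x → x ≢ 0# → Σ (Fin q) (λ y → x * y ≡ 1#)

module LinAlg {q : ℕ} (F : FiniteField q) where
  open FiniteField F

  K : Set
  K = Fin q

  Vecr : ℕ → Set
  Vecr r = Vec K r

  _≟v_ : ∀ {r} (a b : Vecr r) → Dec (a ≡ b)
  _≟v_ = ≡-dec FinP._≟_

  zeroV : ∀ {r} → Vecr r
  zeroV = replicate _ 0#

  _+v_ : ∀ {r} → Vecr r → Vecr r → Vecr r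
  _+v_ = zipWith _+_

  _·v_ : ∀ {r} → K → Vecr r → Vecr r
  c ·v v = map (c *_) v

  allK : List K
  allK = L.allFin q

  allVecs : (r : ℕ) → List (Vecr r)
  allVecs zero    = [] ∷ []
  allVecs (suc r) = concatMap (λ c → L.map (c ∷_) (allVecs r)) allK

  sumK : ∀ {A : Set} → List A → (A → K) → K
  sumK xs f = foldr (λ x acc → f x + acc) 0# xs

  sumV : ∀ {A : Set} {r} → List A → (A → Vecr r) → Vecr r
  sumV xs f = foldr (λ x acc → f x +v acc) zeroV xs

  sumFin : ∀ {k} → (Fin k → K) → K
  sumFin f = sumK (L.allFin _) f

  Space : Set → Set
  Space I = I → K

  LinIndep : ∀ {I : Set} {k : ℕ} → (Fin k → Space I) → Set
  LinIndep {I} {k} v =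
    (c : Fin k → K) →
    (∀ (x : I) → sumFin (λ i → c i * v i x) ≡ 0#) →
    ∀ i → c i ≡ 0#

  -- HasRank S k : the F_q-linear span of the set S has dimension k,
  -- i.e. k is the maximal number of linearly independent elements of S.
  HasRank : ∀ {I : Set} → (Space I → Set) → ℕ → Set
  HasRank {I} S k =
    Σ (Fin k → Space I) (λ v → (∀ i → S (v i)) × LinIndep v)
    × (∀ (w : Fin (suc k) → Space I) → (∀ i → S (w i)) → ¬ LinIndep w)

  module Codes (r n : ℕ) (H : Fin n → Vecr r) where

    syndrome : Space (Fin n) → Vecr r
    syndrome x = sumV (L.allFin n) (λ j → x j ·v H j)

    Ca : Vecr r → Space (Fin n) → Set
    Ca a x = syndrome x ≡ a

    -- length q^r vectors, coordinates indexed by F_q^r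
    Pos : Set
    Pos = Vecr r

    D : Space Pos → Set
    D y = (sumK (allVecs r) y ≡ 0#)
        × (sumV (allVecs r) (λ a → y a ·v a) ≡ zeroV)

    e : Pos → Space Pos
    e a b with a ≟v b
    ... | yes _ = 1#
    ... | no  _ = 0#

    -- D_a = D + e_0 - e_a  (y ∈ D_a iff y - e_0 + e_a ∈ D)
    Da : Pos → Space Pos → Set
    Da a y = D (λ b → (y b + - e zeroV b) + e a b)

    -- action of a permutation on vectors of length q^r:
    -- τ(y) has entry y_a at position τ(a)
    act : (Pos ↔ Pos) → Space Pos → Space Pos
    act τ y b = y (Inverse.from τ b)

    τD : (Pos ↔ Pos) → Space Pos → Set
    τD τ z = Σ (Space Pos) (λ y → D y × (∀ b → z b ≡ act τ y b))

    -- distension of τ is l : dim D − dim (D ∩ τ(D)) = l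
    Distension : (Pos ↔ Pos) → ℕ → Set
    Distension τ l =
      Σ ℕ (λ d → Σ ℕ (λ d' →
        HasRank D d × HasRank (λ y → D y × τD τ y) d' × (d ≡ d' Data.Nat.+ l)))

    concat : Space (Fin n) → Space Pos → Space (Fin n ⊎ Pos)
    concat x y (inj₁ j) = x j
    concat x y (inj₂ a) = y a

    Sτ : (Pos ↔ Pos) → Space (Fin n ⊎ Pos) → Set
    Sτ τ z = Σ Pos (λ a → Σ (Space (Fin n)) (λ x → Σ (Space Pos) (λ y →
               Ca a x × Da (Inverse.to τ a) y × (∀ i → z i ≡ concat x y i))))

  -- H's columns are representatives of the n distinct one-dimensional
  -- subspaces of F_q^r.
  IsHammingCheck : (r n : ℕ) → (Fin n → Vecr r) → Set
  IsHammingCheck r n H =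
      (∀ j → H j ≢ zeroV)
    × (∀ (v : Vecr r) → v ≢ zeroV → Σ (Fin n) (λ j → Σ K (λ c → v ≡ c ·v H j)))
    × (∀ (j j' : Fin n) → j ≢ j' → ∀ (c : K) → H j ≢ c ·v H j')

module Submission where

-- Write Φ y = (Σ_a y_a , Σ_a y_a a) for the check map of D, so that D = ker Φ and Φ is constant,
-- equal to (0 , -b), on D_b.  Then S_τ is the set of (x | y) whose syndrome (H x , Φ y) is one of
-- the points T a = (a , 0 , -τ a), and this syndrome map onto F_q^(2r+1) is surjective because H is
-- a Hamming check matrix.  As τ fixes 0, T 0 = 0 and the kernel of the syndrome map lies in S_τ, so
-- the span of S_τ is the preimage of the span of the T a: its dimension is (n + q^r - 2r - 1) + R
-- with R = dim span {T a}.
-- On the other side y ∈ τ(D) iff y ∘ τ ∈ D, and Σ (y ∘ τ) = Σ y, so D ∩ τ(D) is the kernel of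
-- y ↦ (- Σ_a y_(τ a) a , Φ y), which sends e_(τ a) to E - T a with E = (0 , 1 , 0).  Its image is
-- spanned by E and the T a, so dim (D ∩ τ(D)) = q^r - 1 - R while dim D = q^r - 1 - r.  Hence
-- l = R - r and rank S_τ = n + q^r - r - 1 + l.

open import Defs
open import Level using (0ℓ)
open import Algebra.Bundles using (CommutativeRing)
import Algebra.Properties.Ring as RingProperties
import Algebra.Properties.Semiring.Sum as SemiringSum
open import Data.Empty using (⊥-elim)
open import Data.Fin as Fin using (Fin; zero; suc; _↑ˡ_; _↑ʳ_; splitAt; punchIn)
import Data.Fin.Permutation as Permutation
import Data.Fin.Properties as Fin
import Data.List as List
import Data.List.Properties as List
open import Data.Nat as ℕ using (ℕ; suc; _≤_; z≤n; s≤s)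
import Data.Nat.Properties as ℕ
open import Data.Product using (Σ; Σ-syntax; _×_; _,_; proj₁; proj₂; uncurry)
open import Data.Sum using (_⊎_; inj₁; inj₂)
open import Data.Sum.Function.Propositional using (_⊎-↔_)
open import Data.Unit using (tt)
import Data.Vec as Vec
open import Data.Vec using (lookup)
import Data.Vec.Properties as Vec
open import Data.Vec.Functional using (_∷_; _++_; tail; insertAt; removeAt)
open import Data.Vec.Functional.Properties
  using (∷-cong; lookup-++ˡ; lookup-++ʳ; insertAt-lookup; insertAt-punchIn)
open import Function using (_∘_; id; flip)
open import Function.Bundles using (_↔_; Inverse; mk↔ₛ′; Injection)
open import Function.Properties.Inverse using (↔-refl; ↔-sym; ↔-trans; ↔⇒↣)
open import Relation.Binary.Definitions using (DecidableEquality)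
open import Relation.Binary.PropositionalEquality
open import Relation.Nullary using (¬_; Dec; yes; no; ¬?)
open import Relation.Nullary.Decidable using (decidable-stable)
open import Relation.Unary using (Pred; U; _⊆_; _≐_)

↑-cases : ∀ {a b} {P : Fin (a ℕ.+ b) → Set} →
          (∀ i → P (i ↑ˡ b)) → (∀ j → P (a ↑ʳ j)) → ∀ k → P k
↑-cases {a} {P = P} left right k with splitAt a k in eq
... | inj₁ i = subst P (Fin.splitAt⁻¹-↑ˡ eq) (left i)
... | inj₂ j = subst P (Fin.splitAt⁻¹-↑ʳ eq) (right j)

↑ˡ≢↑ʳ : ∀ {a b} (i : Fin a) (j : Fin b) → i ↑ˡ b ≢ a ↑ʳ j
↑ˡ≢↑ʳ {a} {b} i j eq
  with trans (sym (Fin.splitAt-↑ˡ a i b)) (trans (cong (splitAt a) eq) (Fin.splitAt-↑ʳ a b j))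
... | ()

module LinearAlgebra {q : ℕ} (F : FiniteField q) where

  open FiniteField F
  open LinAlg F
  open ≡-Reasoning

  commutativeRing : CommutativeRing 0ℓ 0ℓ
  commutativeRing = record { isCommutativeRing = isCommutativeRing }

  open CommutativeRing commutativeRing public
    using ( +-assoc; +-comm; +-identityˡ; +-identityʳ; -‿inverseˡ; -‿inverseʳ
          ; *-assoc; *-comm; *-identityˡ; *-identityʳ; distribˡ; distribʳ; zeroˡ; zeroʳ )
  open RingProperties (CommutativeRing.ring commutativeRing) public
    using ( -0#≈0#; -‿involutive; -‿injective; -‿anti-homo-+; -‿distribˡ-*; -‿distribʳ-*
          ; -1*x≈-x; +-inverseˡ-unique; x∙y⁻¹≈ε⇒x≈y; x≈y⇒x∙y⁻¹≈ε )
  open SemiringSum (CommutativeRing.semiring commutativeRing) public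
    using ( sum; sum-syntax; sum-cong-≗; sum-remove; sum-replicate-zero; ∑-distrib-+; ∑-comm
          ; ∑-permute; *-distribˡ-sum; *-distribʳ-sum )

  x*-1≡-x : ∀ x → x * - 1# ≡ - x
  x*-1≡-x x = trans (sym (-‿distribʳ-* x 1#)) (cong -_ (*-identityʳ x))

  x-y+y≡x : ∀ x y → x + - y + y ≡ x
  x-y+y≡x x y = trans (+-assoc x (- y) y) (trans (cong (x +_) (-‿inverseˡ y)) (+-identityʳ x))

  x-[x-y]≡y : ∀ x y → x + - (x + - y) ≡ y
  x-[x-y]≡y x y = begin
    x + - (x + - y)    ≡⟨ cong (x +_) (-‿anti-homo-+ x (- y)) ⟩
    x + (- - y + - x)  ≡⟨ cong (λ t → x + (t + - x)) (-‿involutive y) ⟩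
    x + (y + - x)      ≡⟨ cong (x +_) (+-comm y (- x)) ⟩
    x + (- x + y)      ≡⟨ +-assoc x (- x) y ⟨
    x + - x + y        ≡⟨ cong (_+ y) (-‿inverseʳ x) ⟩
    0# + y             ≡⟨ +-identityˡ y ⟩
    y                  ∎

  -x*y+[z+x*y]≡z : ∀ x y z → - x * y + (z + x * y) ≡ z
  -x*y+[z+x*y]≡z x y z = begin
    - x * y + (z + x * y)    ≡⟨ cong₂ _+_ (sym (-‿distribˡ-* x y)) (+-comm z (x * y)) ⟩
    - (x * y) + (x * y + z)  ≡⟨ +-assoc _ _ z ⟨
    - (x * y) + x * y + z    ≡⟨ cong (_+ z) (-‿inverseˡ (x * y)) ⟩
    0# + z                   ≡⟨ +-identityˡ z ⟩
    z                        ∎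

  ax+y≡0⇒x≡-πy : ∀ {a π x y} → a * π ≡ 1# → a * x + y ≡ 0# → x ≡ - π * y
  ax+y≡0⇒x≡-πy {a} {π} {x} {y} aπ≡1 ax+y≡0 = begin
    x            ≡⟨ *-identityˡ x ⟨
    1# * x       ≡⟨ cong (_* x) (trans (sym aπ≡1) (*-comm a π)) ⟩
    π * a * x    ≡⟨ *-assoc π a x ⟩
    π * (a * x)  ≡⟨ cong (π *_) (+-inverseˡ-unique (a * x) y ax+y≡0) ⟩
    π * - y      ≡⟨ -‿distribʳ-* π y ⟨
    - (π * y)    ≡⟨ -‿distribˡ-* π y ⟩
    - π * y      ∎

  ∑-zero : ∀ {k} {f : Fin k → K} → (∀ i → f i ≡ 0#) → ∑[ i < k ] f i ≡ 0#
  ∑-zero {k} f≗0 = trans (sum-cong-≗ f≗0) (sum-replicate-zero k)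

  ∑-single : ∀ {k} (f : Fin k → K) i → (∀ j → j ≢ i → f j ≡ 0#) → ∑[ j < k ] f j ≡ f i
  ∑-single {suc k} f i vanishes = begin
    sum f                     ≡⟨ sum-remove f ⟩
    f i + sum (removeAt f i)  ≡⟨ cong (f i +_) (∑-zero (λ j → vanishes _ (Fin.punchInᵢ≢i i j))) ⟩
    f i + 0#                  ≡⟨ +-identityʳ (f i) ⟩
    f i                       ∎

  ∑-neg : ∀ {k} (f : Fin k → K) → ∑[ i < k ] (- f i) ≡ - (∑[ i < k ] f i)
  ∑-neg {k} f = begin
    ∑[ i < k ] (- f i)       ≡⟨ sum-cong-≗ (λ i → sym (-1*x≈-x (f i))) ⟩
    ∑[ i < k ] (- 1# * f i)  ≡⟨ *-distribˡ-sum (- 1#) f ⟨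
    - 1# * (∑[ i < k ] f i)  ≡⟨ -1*x≈-x _ ⟩
    - (∑[ i < k ] f i)       ∎

  ∑-split : ∀ a {b} (f : Fin (a ℕ.+ b) → K) →
            ∑[ i < a ℕ.+ b ] f i ≡ ∑[ i < a ] f (i ↑ˡ b) + ∑[ j < b ] f (a ↑ʳ j)
  ∑-split ℕ.zero  f = sym (+-identityˡ _)
  ∑-split (suc a) f = trans (cong (f zero +_) (∑-split a (f ∘ suc))) (sym (+-assoc _ _ _))

  ∑-combine : ∀ a b (g : Fin (a ℕ.* b) → K) → sum g ≡ ∑[ c < a ] ∑[ j < b ] g (Fin.combine c j)
  ∑-combine ℕ.zero  b g = refl
  ∑-combine (suc a) b g =
    trans (∑-split b g) (cong (∑[ j < b ] g (j ↑ˡ a ℕ.* b) +_) (∑-combine a b (g ∘ (b ↑ʳ_))))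

  sumK-++ : ∀ {A : Set} (xs ys : List.List A) (f : A → K) →
            sumK (xs List.++ ys) f ≡ sumK xs f + sumK ys f
  sumK-++ List.[]       ys f = sym (+-identityˡ _)
  sumK-++ (x List.∷ xs) ys f = trans (cong (f x +_) (sumK-++ xs ys f)) (sym (+-assoc _ _ _))

  sumK-concatMap : ∀ {A B : Set} (h : A → List.List B) (xs : List.List A) (f : B → K) →
                   sumK (List.concatMap h xs) f ≡ sumK xs (λ a → sumK (h a) f)
  sumK-concatMap h List.[]       f = refl
  sumK-concatMap h (x List.∷ xs) f =
    trans (sumK-++ (h x) (List.concatMap h xs) f) (cong (sumK (h x) f +_) (sumK-concatMap h xs f))

  sumFin≡∑ : ∀ {k} (f : Fin k → K) → sumFin f ≡ ∑[ i < k ] f i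
  sumFin≡∑ = tabulated {g = id}
    where
    tabulated : ∀ {A : Set} {k} {g : Fin k → A} (f : A → K) →
                sumK (List.tabulate g) f ≡ sum (f ∘ g)
    tabulated {k = ℕ.zero} f = refl
    tabulated {k = suc k} {g} f = cong (f (g zero) +_) (tabulated {g = g ∘ suc} f)

  δ⟨_⟩ : ∀ {A : Set} → DecidableEquality A → A → A → K
  δ⟨ _≟_ ⟩ a b with a ≟ b
  ... | yes _ = 1#
  ... | no  _ = 0#

  module _ {A : Set} (_≟_ : DecidableEquality A) where

    δ-diag : ∀ a → δ⟨ _≟_ ⟩ a a ≡ 1#
    δ-diag a with a ≟ a
    ... | yes _   = refl
    ... | no  a≢a = ⊥-elim (a≢a refl)

    δ-off : ∀ {a b} → a ≢ b → δ⟨ _≟_ ⟩ a b ≡ 0#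
    δ-off {a} {b} a≢b with a ≟ b
    ... | yes a≡b = ⊥-elim (a≢b a≡b)
    ... | no  _   = refl

    δ-injective : ∀ {B : Set} (_≟′_ : DecidableEquality B) {f : B → A} → (∀ {x y} → f x ≡ f y → x ≡ y) →
                  ∀ x y → δ⟨ _≟_ ⟩ (f x) (f y) ≡ δ⟨ _≟′_ ⟩ x y
    δ-injective _≟′_ f-injective x y with x ≟′ y
    ... | yes refl = δ-diag _
    ... | no  x≢y  = δ-off (x≢y ∘ f-injective)

  δ : ∀ {k} → Fin k → Fin k → K
  δ = δ⟨ Fin._≟_ ⟩

  ∑-δˡ : ∀ {k} (i : Fin k) (f : Fin k → K) → ∑[ j < k ] (δ i j * f j) ≡ f i
  ∑-δˡ {k} i f = begin
    ∑[ j < k ] (δ i j * f j)  ≡⟨ ∑-single _ i δf-off ⟩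
    δ i i * f i               ≡⟨ cong (_* f i) (δ-diag Fin._≟_ i) ⟩
    1# * f i                  ≡⟨ *-identityˡ (f i) ⟩
    f i                       ∎
    where
    δf-off : ∀ j → j ≢ i → δ i j * f j ≡ 0#
    δf-off j j≢i = trans (cong (_* f j) (δ-off Fin._≟_ (j≢i ∘ sym))) (zeroˡ (f j))

  ∑-δʳ : ∀ {k} (i : Fin k) (f : Fin k → K) → ∑[ j < k ] (f j * δ j i) ≡ f i
  ∑-δʳ {k} i f = begin
    ∑[ j < k ] (f j * δ j i)  ≡⟨ ∑-single _ i fδ-off ⟩
    f i * δ i i               ≡⟨ cong (f i *_) (δ-diag Fin._≟_ i) ⟩
    f i * 1#                  ≡⟨ *-identityʳ (f i) ⟩
    f i                       ∎
    where
    fδ-off : ∀ j → j ≢ i → f j * δ j i ≡ 0#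
    fδ-off j j≢i = trans (cong (f j *_) (δ-off Fin._≟_ j≢i)) (zeroʳ (f j))

  infixl 6 _+ₛ_ _-ₛ_
  infixr 7 _·ₛ_
  infix 4 _∈span_

  0ₛ : ∀ {I} → Space I
  0ₛ _ = 0#

  _+ₛ_ : ∀ {I} → Space I → Space I → Space I
  (z +ₛ w) x = z x + w x

  _-ₛ_ : ∀ {I} → Space I → Space I → Space I
  (z -ₛ w) x = z x + - w x

  _·ₛ_ : ∀ {I} → K → Space I → Space I
  (a ·ₛ z) x = a * z x

  lincomb : ∀ {I k} → (Fin k → K) → (Fin k → Space I) → Space I
  lincomb {k = k} c v x = ∑[ i < k ] (c i * v i x)

  Independent : ∀ {I k} → (Fin k → Space I) → Set
  Independent v = ∀ c → lincomb c v ≗ 0ₛ → ∀ i → c i ≡ 0#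

  _∈span_ : ∀ {I k} → Space I → (Fin k → Space I) → Set
  _∈span_ {k = k} z v = Σ[ c ∈ (Fin k → K) ] z ≗ lincomb c v

  lincomb-congˡ : ∀ {I k} {c d : Fin k → K} (v : Fin k → Space I) → c ≗ d → lincomb c v ≗ lincomb d v
  lincomb-congˡ v c≗d x = sum-cong-≗ (λ i → cong (_* v i x) (c≗d i))

  lincomb-congʳ : ∀ {I k} (c : Fin k → K) {v w : Fin k → Space I} → (∀ i → v i ≗ w i) →
                  lincomb c v ≗ lincomb c w
  lincomb-congʳ c v≗w x = sum-cong-≗ (λ i → cong (c i *_) (v≗w i x))

  lincomb-zeroˡ : ∀ {I k} (v : Fin k → Space I) → lincomb (λ _ → 0#) v ≗ 0ₛ
  lincomb-zeroˡ v x = ∑-zero (λ i → zeroˡ (v i x))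

  lincomb-zeroʳ : ∀ {I k} (c : Fin k → K) {v : Fin k → Space I} →
                  (∀ i → v i ≗ 0ₛ) → lincomb c v ≗ 0ₛ
  lincomb-zeroʳ c v≗0 x = ∑-zero (λ i → trans (cong (c i *_) (v≗0 i x)) (zeroʳ (c i)))

  lincomb-+ : ∀ {I k} (c d : Fin k → K) (v : Fin k → Space I) →
              lincomb (λ i → c i + d i) v ≗ lincomb c v +ₛ lincomb d v
  lincomb-+ c d v x = trans (sum-cong-≗ (λ i → distribʳ (v i x) (c i) (d i)))
                            (∑-distrib-+ (λ i → c i * v i x) (λ i → d i * v i x))

  lincomb-· : ∀ {I k} a (c : Fin k → K) (v : Fin k → Space I) →
              lincomb (λ i → a * c i) v ≗ a ·ₛ lincomb c v
  lincomb-· a c v x = trans (sum-cong-≗ (λ i → *-assoc a (c i) (v i x)))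
                            (sym (*-distribˡ-sum a (λ i → c i * v i x)))

  lincomb-δ : ∀ {I k} (v : Fin k → Space I) i → lincomb (δ i) v ≗ v i
  lincomb-δ v i x = ∑-δˡ i (λ j → v j x)

  lincomb-lincomb : ∀ {I k m} (c : Fin m → K) (A : Fin m → Fin k → K) (v : Fin k → Space I) →
                    lincomb c (λ j → lincomb (A j) v) ≗ lincomb (lincomb c A) v
  lincomb-lincomb {k = k} {m} c A v x = begin
    ∑[ j < m ] (c j * ∑[ i < k ] (A j i * v i x))
      ≡⟨ sum-cong-≗ (λ j → *-distribˡ-sum (c j) (λ i → A j i * v i x)) ⟩
    ∑[ j < m ] ∑[ i < k ] (c j * (A j i * v i x))
      ≡⟨ ∑-comm (λ j i → c j * (A j i * v i x)) ⟩
    ∑[ i < k ] ∑[ j < m ] (c j * (A j i * v i x))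
      ≡⟨ sum-cong-≗ (λ i → sum-cong-≗ (λ j → sym (*-assoc (c j) (A j i) (v i x)))) ⟩
    ∑[ i < k ] ∑[ j < m ] (c j * A j i * v i x)
      ≡⟨ sum-cong-≗ (λ i → sym (*-distribʳ-sum (v i x) (λ j → c j * A j i))) ⟩
    ∑[ i < k ] (∑[ j < m ] (c j * A j i) * v i x)
      ∎

  lincomb-++ : ∀ {I} a {b} (c : Fin (a ℕ.+ b) → K) (v : Fin a → Space I) (w : Fin b → Space I) →
               lincomb c (v ++ w) ≗ lincomb (c ∘ (_↑ˡ b)) v +ₛ lincomb (c ∘ (a ↑ʳ_)) w
  lincomb-++ a {b} c v w x = trans (∑-split a (λ i → c i * (v ++ w) i x))
    (cong₂ _+_ (sum-cong-≗ (λ i → cong (λ u → c (i ↑ˡ b) * u x) (lookup-++ˡ v w i)))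
               (sum-cong-≗ (λ j → cong (λ u → c (a ↑ʳ j) * u x) (lookup-++ʳ v w j))))

  ∈span-resp : ∀ {I k} {v : Fin k → Space I} {z w : Space I} → z ≗ w → z ∈span v → w ∈span v
  ∈span-resp z≗w (c , z≗) = c , λ x → trans (sym (z≗w x)) (z≗ x)

  ∈span-member : ∀ {I k} (v : Fin k → Space I) i → v i ∈span v
  ∈span-member v i = δ i , λ x → sym (lincomb-δ v i x)

  ∈span-+ : ∀ {I k} {v : Fin k → Space I} {z w : Space I} → z ∈span v → w ∈span v → z +ₛ w ∈span v
  ∈span-+ {v = v} (c , z≗) (d , w≗) =
    (λ i → c i + d i) , λ x → trans (cong₂ _+_ (z≗ x) (w≗ x)) (sym (lincomb-+ c d v x))

  ∈span-· : ∀ {I k} {v : Fin k → Space I} {z : Space I} a → z ∈span v → a ·ₛ z ∈span v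
  ∈span-· {v = v} a (c , z≗) =
    (λ i → a * c i) , λ x → trans (cong (a *_) (z≗ x)) (sym (lincomb-· a c v x))

  ∈span-trans : ∀ {I k m} {v : Fin k → Space I} {w : Fin m → Space I} {z : Space I} →
                z ∈span v → (∀ i → v i ∈span w) → z ∈span w
  ∈span-trans {v = v} {w} (c , z≗) v∈span = lincomb c (proj₁ ∘ v∈span) , λ x →
    trans (z≗ x) (trans (lincomb-congʳ c (proj₂ ∘ v∈span) x) (lincomb-lincomb c (proj₁ ∘ v∈span) w x))

  ∈span-∷ : ∀ {I k} {v : Fin k → Space I} {z : Space I} u → z ∈span v → z ∈span (u ∷ v)
  ∈span-∷ {v = v} u (c , z≗) = (0# ∷ c) , λ x →
    trans (z≗ x) (sym (trans (cong (_+ lincomb c v x) (zeroˡ (u x))) (+-identityˡ _)))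

  tail-relation : ∀ {I k} {u : Space I} {v : Fin k → Space I} (c : Fin (suc k) → K) →
                  c zero ≡ 0# → lincomb c (u ∷ v) ≗ 0ₛ → lincomb (tail c) v ≗ 0ₛ
  tail-relation {u = u} {v} c c₀≡0 rel x = begin
    lincomb (tail c) v x                 ≡⟨ +-identityˡ _ ⟨
    0# + lincomb (tail c) v x            ≡⟨ cong (_+ lincomb (tail c) v x) (zeroˡ (u x)) ⟨
    0# * u x + lincomb (tail c) v x      ≡⟨ cong (λ a → a * u x + lincomb (tail c) v x) c₀≡0 ⟨
    c zero * u x + lincomb (tail c) v x  ≡⟨ rel x ⟩
    0#                                   ∎

  head-relation⇒∈span : ∀ {I k} {u : Space I} {v : Fin k → Space I} (c : Fin (suc k) → K) →
                        c zero ≢ 0# → lincomb c (u ∷ v) ≗ 0ₛ → u ∈span v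
  head-relation⇒∈span {v = v} c c₀≢0 rel = (λ i → - π * c (suc i)) , λ x →
    trans (ax+y≡0⇒x≡-πy c₀π≡1 (rel x)) (sym (lincomb-· (- π) (tail c) v x))
    where
    π = proj₁ (inverse (c zero) c₀≢0)
    c₀π≡1 = proj₂ (inverse (c zero) c₀≢0)

  independent-tail : ∀ {I k} {v : Fin (suc k) → Space I} → Independent v → Independent (tail v)
  independent-tail {v = v} indep c rel i = indep (0# ∷ c) shifted-rel (suc i)
    where
    shifted-rel : lincomb (0# ∷ c) v ≗ 0ₛ
    shifted-rel x = trans (cong (_+ lincomb c (tail v) x) (zeroˡ (v zero x))) (trans (+-identityˡ _) (rel x))

  independent-∷ : ∀ {I k} {u : Space I} {v : Fin k → Space I} →
                  ¬ u ∈span v → Independent v → Independent (u ∷ v)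
  independent-∷ u∉span indep c rel with c zero Fin.≟ 0#
  ... | no  c₀≢0 = ⊥-elim (u∉span (head-relation⇒∈span c c₀≢0 rel))
  ... | yes c₀≡0 = λ { zero → c₀≡0 ; (suc i) → indep (tail c) (tail-relation c c₀≡0 rel) i }

  Independent⇒LinIndep : ∀ {I k} {v : Fin k → Space I} → Independent v → LinIndep v
  Independent⇒LinIndep {v = v} indep c rel =
    indep c (λ x → trans (sym (sumFin≡∑ (λ i → c i * v i x))) (rel x))

  LinIndep⇒Independent : ∀ {I k} {v : Fin k → Space I} → LinIndep v → Independent v
  LinIndep⇒Independent {v = v} indep c rel =
    indep c (λ x → trans (sumFin≡∑ (λ i → c i * v i x)) (rel x))

  record Basis {I : Set} (P : Pred (Space I) 0ℓ) (k : ℕ) : Set where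
    field
      vec         : Fin k → Space I
      member      : ∀ i → P (vec i)
      independent : Independent vec
      spanning    : ∀ {z} → P z → z ∈span vec

  enumeration-basis : ∀ {I M} → Fin M ↔ I → Basis {I} U M
  enumeration-basis enumeration = record
    { vec         = λ k x → δ k (from x)
    ; member      = λ _ → tt
    ; independent = λ c rel i → begin
        c i                                      ≡⟨ ∑-δʳ i c ⟨
        ∑[ k < _ ] (c k * δ k i)                 ≡⟨ sum-cong-≗ (λ k → cong ((c k *_) ∘ δ k) (strictlyInverseʳ i)) ⟨
        lincomb c (λ k x → δ k (from x)) (to i)  ≡⟨ rel (to i) ⟩
        0#                                       ∎
    ; spanning    = λ {z} _ → z ∘ to , λ x →
        sym (trans (∑-δʳ (from x) (z ∘ to)) (cong z (strictlyInverseˡ x)))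
    }
    where open Inverse enumeration

  standard-basis : ∀ m → Basis {Fin m} U m
  standard-basis m = enumeration-basis ↔-refl

  Basis-restrict : ∀ {I k} {P Q : Pred (Space I) 0ℓ} (B : Basis P k) →
                   Q ⊆ P → (∀ i → Q (Basis.vec B i)) → Basis Q k
  Basis-restrict B Q⊆P vec∈Q = record
    { vec = vec ; member = vec∈Q ; independent = independent ; spanning = spanning ∘ Q⊆P }
    where open Basis B

  -- The Steinitz bound

  module PivotElimination {k m} (w : Fin (suc m) → Space (Fin (suc k))) (p : Fin (suc m))
                          {π : K} (pivot : w p zero * π ≡ 1#) where

    factor : Fin m → K
    factor j = w (punchIn p j) zero * π

    eliminated : Fin m → Space (Fin (suc k))
    eliminated j = w (punchIn p j) -ₛ factor j ·ₛ w p

    eliminated-zero : ∀ j → eliminated j zero ≡ 0#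
    eliminated-zero j = begin
      a + - (a * π * w p zero)    ≡⟨ cong (λ t → a + - t) (*-assoc a π (w p zero)) ⟩
      a + - (a * (π * w p zero))  ≡⟨ cong (λ t → a + - (a * t)) (trans (*-comm π (w p zero)) pivot) ⟩
      a + - (a * 1#)              ≡⟨ cong (λ t → a + - t) (*-identityʳ a) ⟩
      a + - a                     ≡⟨ -‿inverseʳ a ⟩
      0#                          ∎
      where a = w (punchIn p j) zero

    pivot-coefficient : (Fin m → K) → K
    pivot-coefficient c = ∑[ j < m ] (- (c j * factor j))

    lincomb-eliminated : ∀ c → lincomb (insertAt c p (pivot-coefficient c)) w ≗ lincomb c eliminated
    lincomb-eliminated c x = begin
      lincomb c′ w x
        ≡⟨ sum-remove (λ i → c′ i * w i x) ⟩
      c′ p * w p x + ∑[ j < m ] (c′ (punchIn p j) * w (punchIn p j) x)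
        ≡⟨ cong₂ _+_ (cong (_* w p x) (insertAt-lookup c p A))
                     (sum-cong-≗ (λ j → cong (_* w (punchIn p j) x) (insertAt-punchIn c p A j))) ⟩
      A * w p x + ∑[ j < m ] (c j * w (punchIn p j) x)
        ≡⟨ +-comm _ _ ⟩
      ∑[ j < m ] (c j * w (punchIn p j) x) + A * w p x
        ≡⟨ cong (_ +_) (*-distribʳ-sum (w p x) (λ j → - (c j * factor j))) ⟩
      ∑[ j < m ] (c j * w (punchIn p j) x) + ∑[ j < m ] (- (c j * factor j) * w p x)
        ≡⟨ ∑-distrib-+ (λ j → c j * w (punchIn p j) x) (λ j → - (c j * factor j) * w p x) ⟨
      ∑[ j < m ] (c j * w (punchIn p j) x + - (c j * factor j) * w p x)
        ≡⟨ sum-cong-≗ (λ j → distribute (c j) (w (punchIn p j) x) (factor j) (w p x)) ⟩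
      lincomb c eliminated x
        ∎
      where
      A = pivot-coefficient c
      c′ = insertAt c p A
      distribute : ∀ a b f t → a * b + - (a * f) * t ≡ a * (b + - (f * t))
      distribute a b f t = begin
        a * b + - (a * f) * t    ≡⟨ cong (a * b +_) (-‿distribˡ-* (a * f) t) ⟨
        a * b + - (a * f * t)    ≡⟨ cong (λ s → a * b + - s) (*-assoc a f t) ⟩
        a * b + - (a * (f * t))  ≡⟨ cong (a * b +_) (-‿distribʳ-* a (f * t)) ⟩
        a * b + a * - (f * t)    ≡⟨ distribˡ a b (- (f * t)) ⟨
        a * (b + - (f * t))      ∎

    eliminated-independent : Independent w → Independent (tail ∘ eliminated)
    eliminated-independent indep c rel j = begin
      c j                           ≡⟨ insertAt-punchIn c p A j ⟨
      insertAt c p A (punchIn p j)  ≡⟨ indep (insertAt c p A) full-relation (punchIn p j) ⟩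
      0#                            ∎
      where
      A = pivot-coefficient c
      full-relation : lincomb (insertAt c p A) w ≗ 0ₛ
      full-relation zero    = trans (lincomb-eliminated c zero)
                                    (∑-zero (λ j → trans (cong (c j *_) (eliminated-zero j)) (zeroʳ (c j))))
      full-relation (suc x) = trans (lincomb-eliminated c (suc x)) (rel x)

  independent⇒≤ : ∀ k {m} {w : Fin m → Space (Fin k)} → Independent w → m ≤ k
  independent⇒≤ ℕ.zero  {ℕ.zero} _     = z≤n
  independent⇒≤ ℕ.zero  {suc m}  indep = ⊥-elim (0≢1 (sym (indep (λ _ → 1#) (λ ()) zero)))
  independent⇒≤ (suc k) {ℕ.zero} _     = z≤n
  independent⇒≤ (suc k) {suc m} {w} indep with Fin.any? (λ p → ¬? (w p zero Fin.≟ 0#))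
  ... | yes (p , w₀≢0) = s≤s (independent⇒≤ k {w = tail ∘ eliminated} (eliminated-independent indep))
    where open PivotElimination w p (proj₂ (inverse (w p zero) w₀≢0))
  ... | no no-pivot = ℕ.m≤n⇒m≤1+n (independent⇒≤ k {w = tail ∘ w} tails-independent)
    where
    column-zero : ∀ p → w p zero ≡ 0#
    column-zero p = decidable-stable (w p zero Fin.≟ 0#) (λ w₀≢0 → no-pivot (p , w₀≢0))
    tails-independent : Independent (tail ∘ w)
    tails-independent c rel = indep c λ
      { zero    → ∑-zero (λ p → trans (cong (c p *_) (column-zero p)) (zeroʳ (c p)))
      ; (suc x) → rel x }

  independent-in-span⇒≤ : ∀ {I k m} (v : Fin k → Space I) {w : Fin m → Space I} →
                          Independent w → (∀ i → w i ∈span v) → m ≤ k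
  independent-in-span⇒≤ {k = k} v {w} indep w∈span =
    independent⇒≤ k {w = coefficients} coefficients-independent
    where
    coefficients = proj₁ ∘ w∈span
    coefficients-independent : Independent coefficients
    coefficients-independent c rel = indep c λ x → begin
      lincomb c w x                                  ≡⟨ lincomb-congʳ c (proj₂ ∘ w∈span) x ⟩
      lincomb c (λ i → lincomb (coefficients i) v) x ≡⟨ lincomb-lincomb c coefficients v x ⟩
      lincomb (lincomb c coefficients) v x           ≡⟨ lincomb-congˡ v rel x ⟩
      lincomb (λ _ → 0#) v x                         ≡⟨ lincomb-zeroˡ v x ⟩
      0#                                             ∎

  Basis-≤ : ∀ {I a b} {P Q : Pred (Space I) 0ℓ} → Basis P a → Basis Q b → P ⊆ Q → a ≤ b
  Basis-≤ A B P⊆Q = independent-in-span⇒≤ (Basis.vec B) (Basis.independent A)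
                                           (λ i → Basis.spanning B (P⊆Q (Basis.member A i)))

  Basis-unique : ∀ {I a b} {P Q : Pred (Space I) 0ℓ} → Basis P a → Basis Q b → P ≐ Q → a ≡ b
  Basis-unique A B (P⊆Q , Q⊆P) = ℕ.≤-antisym (Basis-≤ A B P⊆Q) (Basis-≤ B A Q⊆P)

  Basis⇒HasRank : ∀ {I k} {P : Pred (Space I) 0ℓ} → Basis P k → HasRank P k
  Basis⇒HasRank {P = P} B = (vec , member , Independent⇒LinIndep independent) , too-many
    where
    open Basis B
    too-many : ∀ w → (∀ i → P (w i)) → ¬ LinIndep w
    too-many w w∈P w-indep =
      ℕ.<-irrefl refl (independent-in-span⇒≤ vec (LinIndep⇒Independent w-indep) (spanning ∘ w∈P))

  independent⇒≤rank : ∀ {I k d} {P : Pred (Space I) 0ℓ} {v : Fin k → Space I} →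
                      HasRank P d → (∀ i → P (v i)) → Independent v → k ≤ d
  independent⇒≤rank {k = ℕ.zero} _ _ _ = z≤n
  independent⇒≤rank {k = suc k} {P = P} {v} rank@(_ , maximal) v∈P indep
    with ℕ.m≤n⇒m<n∨m≡n (independent⇒≤rank {P = P} {tail v} rank (v∈P ∘ suc)
                                           (independent-tail {v = v} indep))
  ... | inj₁ k<d  = k<d
  ... | inj₂ refl = ⊥-elim (maximal v v∈P (Independent⇒LinIndep indep))

  HasRank-unique : ∀ {I d k} {P : Pred (Space I) 0ℓ} → HasRank P d → Basis P k → d ≡ k
  HasRank-unique {P = P} rank@((u , u∈P , u-indep) , _) B = ℕ.≤-antisym
    (independent-in-span⇒≤ (Basis.vec B) (LinIndep⇒Independent u-indep) (Basis.spanning B ∘ u∈P))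
    (independent⇒≤rank {P = P} rank (Basis.member B) (Basis.independent B))

  record IsLinear {I J : Set} (G : Space I → Space J) : Set where
    field
      ≗-cong : ∀ {z w} → z ≗ w → G z ≗ G w
      +-homo : ∀ z w → G (z +ₛ w) ≗ G z +ₛ G w
      ·-homo : ∀ a z → G (a ·ₛ z) ≗ a ·ₛ G z

    0-homo : G 0ₛ ≗ 0ₛ
    0-homo x = begin
      G 0ₛ x          ≡⟨ ≗-cong (λ _ → sym (zeroˡ 0#)) x ⟩
      G (0# ·ₛ 0ₛ) x  ≡⟨ ·-homo 0# 0ₛ x ⟩
      0# * G 0ₛ x     ≡⟨ zeroˡ _ ⟩
      0#              ∎

    lincomb-homo : ∀ {k} (c : Fin k → K) (v : Fin k → Space I) → G (lincomb c v) ≗ lincomb c (G ∘ v)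
    lincomb-homo {ℕ.zero} c v = 0-homo
    lincomb-homo {suc k}  c v x = begin
      G (c zero ·ₛ v zero +ₛ lincomb (tail c) (tail v)) x
        ≡⟨ +-homo (c zero ·ₛ v zero) (lincomb (tail c) (tail v)) x ⟩
      G (c zero ·ₛ v zero) x + G (lincomb (tail c) (tail v)) x
        ≡⟨ cong₂ _+_ (·-homo (c zero) (v zero) x) (lincomb-homo (tail c) (tail v) x) ⟩
      c zero * G (v zero) x + lincomb (tail c) (G ∘ tail v) x
        ∎

    -‿homo : ∀ z w → G (z -ₛ w) ≗ G z -ₛ G w
    -‿homo z w x = begin
      G (z -ₛ w) x                ≡⟨ ≗-cong (λ y → cong (z y +_) (sym (-1*x≈-x (w y)))) x ⟩
      G (z +ₛ - 1# ·ₛ w) x        ≡⟨ +-homo z _ x ⟩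
      G z x + G (- 1# ·ₛ w) x     ≡⟨ cong (G z x +_) (trans (·-homo (- 1#) w x) (-1*x≈-x (G w x))) ⟩
      G z x + - G w x             ∎

    ∈span-homo : ∀ {k} {v : Fin k → Space I} {z} → z ∈span v → G z ∈span (G ∘ v)
    ∈span-homo {v = v} (c , z≗) = c , λ x → trans (≗-cong z≗ x) (lincomb-homo c v x)

  lincomb-linear : ∀ {I J M} (f : Fin M → I) (A : Fin M → Space J) → IsLinear (λ y → lincomb (y ∘ f) A)
  lincomb-linear f A = record
    { ≗-cong = λ z≗w → lincomb-congˡ A (z≗w ∘ f)
    ; +-homo = λ z w → lincomb-+ (z ∘ f) (w ∘ f) A
    ; ·-homo = λ a z → lincomb-· a (z ∘ f) A
    }

  ++-linear : ∀ {I a b} {G : Space I → Space (Fin a)} {G′ : Space I → Space (Fin b)} →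
              IsLinear G → IsLinear G′ → IsLinear (λ z → G z ++ G′ z)
  ++-linear {a = a} {G = G} {G′} L L′ = record { ≗-cong = ≗-cong ; +-homo = +-homo ; ·-homo = ·-homo }
    where
    ≗-cong : ∀ {z w} → z ≗ w → G z ++ G′ z ≗ G w ++ G′ w
    ≗-cong z≗w i with splitAt a i
    ... | inj₁ j = IsLinear.≗-cong L z≗w j
    ... | inj₂ j = IsLinear.≗-cong L′ z≗w j
    +-homo : ∀ z w → G (z +ₛ w) ++ G′ (z +ₛ w) ≗ (G z ++ G′ z) +ₛ (G w ++ G′ w)
    +-homo z w i with splitAt a i
    ... | inj₁ j = IsLinear.+-homo L z w j
    ... | inj₂ j = IsLinear.+-homo L′ z w j
    ·-homo : ∀ c z → G (c ·ₛ z) ++ G′ (c ·ₛ z) ≗ c ·ₛ (G z ++ G′ z)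
    ·-homo c z i with splitAt a i
    ... | inj₁ j = IsLinear.·-homo L c z j
    ... | inj₂ j = IsLinear.·-homo L′ c z j

  Kernel : ∀ {I J} → (Space I → Space J) → Pred (Space I) 0ℓ
  Kernel G z = G z ≗ 0ₛ

  Image : ∀ {I J} → (Space I → Space J) → Pred (Space J) 0ℓ
  Image {I} G w = Σ[ z ∈ Space I ] G z ≗ w

  -- Gaussian elimination and rank–nullity

  Relation : ∀ {I M} → (Fin M → Space I) → Pred (Space (Fin M)) 0ℓ
  Relation u = Kernel (flip lincomb u)

  ∃-vector? : ∀ k (P : Pred (Fin k → K) 0ℓ) → (∀ {c d} → c ≗ d → P c → P d) →
              (∀ c → Dec (P c)) → Dec (Σ (Fin k → K) P)
  ∃-vector? ℕ.zero P resp P? with P? (λ ())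
  ... | yes p = yes (_ , p)
  ... | no ¬p = no λ (c , p) → ¬p (resp (λ ()) p)
  ∃-vector? (suc k) P resp P?
    with Fin.any? (λ a → ∃-vector? k (P ∘ (a ∷_)) (resp ∘ ∷-cong refl) (P? ∘ (a ∷_)))
  ... | yes (a , c , p) = yes (a ∷ c , p)
  ... | no ¬p = no λ (c , p) → ¬p (c zero , tail c , resp (∷-cong refl (λ _ → refl)) p)

  ∈span? : ∀ {m k} (z : Space (Fin m)) (v : Fin k → Space (Fin m)) → Dec (z ∈span v)
  ∈span? z v = ∃-vector? _ (λ c → z ≗ lincomb c v)
    (λ c≗d z≗ x → trans (z≗ x) (lincomb-congˡ v c≗d x))
    (λ c → Fin.all? (λ x → z x Fin.≟ lincomb c v x))

  record Elimination {m M} (u : Fin M → Space (Fin m)) : Set where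
    field
      rank nullity       : ℕ
      rank+nullity       : rank ℕ.+ nullity ≡ M
      pivot              : Fin rank → Fin M
      pivots-independent : Independent (u ∘ pivot)
      pivots-span        : ∀ i → u i ∈span (u ∘ pivot)
      relations          : Basis (Relation u) nullity

  module _ {m M} (u : Fin (suc M) → Space (Fin m)) where

    shifted-relation : ∀ {c} → Relation (tail u) c → Relation u (0# ∷ c)
    shifted-relation {c} rel x = begin
      0# * u zero x + lincomb c (tail u) x ≡⟨ cong (_+ lincomb c (tail u) x) (zeroˡ (u zero x)) ⟩
      0# + lincomb c (tail u) x            ≡⟨ +-identityˡ _ ⟩
      lincomb c (tail u) x                 ≡⟨ rel x ⟩
      0#                                   ∎

    relations-shift : ∀ {κ} → (∀ {c} → Relation u c → c zero ≡ 0#) →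
                      Basis (Relation (tail u)) κ → Basis (Relation u) κ
    relations-shift head≡0 R = record
      { vec         = λ t → 0# ∷ vec t
      ; member      = shifted-relation ∘ member
      ; independent = λ c rel → independent c (rel ∘ suc)
      ; spanning    = λ {c} rel → let (β , tail≗) = spanning (tail-relation c (head≡0 {c} rel) rel) in
          β , λ { zero    → trans (head≡0 {c} rel) (sym (∑-zero (λ t → zeroʳ (β t))))
                ; (suc x) → tail≗ x }
      }
      where open Basis R

    module RelationsExtension {κ} {γ : Fin M → K} (u₀≗ : u zero ≗ lincomb γ (tail u))
                              (R : Basis (Relation (tail u)) κ) where

      open Basis R

      extended : Fin (suc κ) → Space (Fin (suc M))
      extended = (- 1# ∷ γ) ∷ λ t → 0# ∷ vec t

      new-relation : Relation u (- 1# ∷ γ)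
      new-relation x = begin
        - 1# * u zero x + lincomb γ (tail u) x ≡⟨ cong₂ _+_ (-1*x≈-x (u zero x)) (sym (u₀≗ x)) ⟩
        - u zero x + u zero x                  ≡⟨ -‿inverseˡ (u zero x) ⟩
        0#                                     ∎

      extended-independent : Independent extended
      extended-independent c rel = λ
        { zero    → c₀≡0
        ; (suc t) → independent (tail c) (tail-relation c c₀≡0 (rel ∘ suc)) t }
        where
        c₀≡0 : c zero ≡ 0#
        c₀≡0 = -‿injective (begin
          - c zero                       ≡⟨ x*-1≡-x (c zero) ⟨
          c zero * - 1#                  ≡⟨ +-identityʳ _ ⟨
          c zero * - 1# + 0#             ≡⟨ cong (c zero * - 1# +_) (∑-zero (λ t → zeroʳ (c (suc t)))) ⟨
          lincomb c extended zero        ≡⟨ rel zero ⟩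
          0#                             ≡⟨ -0#≈0# ⟨
          - 0#                           ∎)

      reduced-relation : ∀ {c} → Relation u c → Relation (tail u) (λ i → c (suc i) + c zero * γ i)
      reduced-relation {c} rel x = begin
        lincomb (λ i → c (suc i) + c zero * γ i) (tail u) x
          ≡⟨ lincomb-+ (tail c) (λ i → c zero * γ i) (tail u) x ⟩
        lincomb (tail c) (tail u) x + lincomb (λ i → c zero * γ i) (tail u) x
          ≡⟨ cong (lincomb (tail c) (tail u) x +_) (lincomb-· (c zero) γ (tail u) x) ⟩
        lincomb (tail c) (tail u) x + c zero * lincomb γ (tail u) x
          ≡⟨ cong (λ t → lincomb (tail c) (tail u) x + c zero * t) (u₀≗ x) ⟨
        lincomb (tail c) (tail u) x + c zero * u zero x
          ≡⟨ +-comm _ _ ⟩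
        lincomb c u x
          ≡⟨ rel x ⟩
        0# ∎

      -- c = (- c₀) · (- 1 ∷ γ) + (0 ∷ d) with d the reduced relation of tail u
      extended-spanning : ∀ {c} → Relation u c → c ∈span extended
      extended-spanning {c} rel = (- c zero) ∷ β , λ
        { zero    → sym (begin
            - c zero * - 1# + ∑[ t < κ ] (β t * 0#) ≡⟨ cong (_ +_) (∑-zero (λ t → zeroʳ (β t))) ⟩
            - c zero * - 1# + 0#                    ≡⟨ +-identityʳ _ ⟩
            - c zero * - 1#                         ≡⟨ x*-1≡-x (- c zero) ⟩
            - - c zero                              ≡⟨ -‿involutive (c zero) ⟩
            c zero                                  ∎)
        ; (suc x) → sym (begin
            - c zero * γ x + lincomb β vec x              ≡⟨ cong (- c zero * γ x +_) (d≗ x) ⟨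
            - c zero * γ x + (c (suc x) + c zero * γ x)   ≡⟨ -x*y+[z+x*y]≡z (c zero) (γ x) (c (suc x)) ⟩
            c (suc x)                                     ∎) }
        where
        β = proj₁ (spanning (reduced-relation {c} rel))
        d≗ = proj₂ (spanning (reduced-relation {c} rel))

      basis : Basis (Relation u) (suc κ)
      basis = record
        { vec         = extended
        ; member      = λ { zero → new-relation ; (suc t) → shifted-relation (member t) }
        ; independent = extended-independent
        ; spanning    = extended-spanning
        }

    independent-step : (E : Elimination (tail u)) → ¬ u zero ∈span (tail u ∘ Elimination.pivot E) →
                       Elimination u
    independent-step E u₀∉span = record
      { rank               = suc rank
      ; nullity            = nullity
      ; rank+nullity       = cong suc rank+nullity
      ; pivot              = zero ∷ (suc ∘ pivot)
      ; pivots-independent = independent-∷ u₀∉span pivots-independent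
      ; pivots-span        = λ { zero    → ∈span-member (u zero ∷ (tail u ∘ pivot)) zero
                               ; (suc i) → ∈span-∷ (u zero) (pivots-span i) }
      ; relations          = relations-shift (λ {c} → head≡0 {c}) relations
      }
      where
      open Elimination E
      head≡0 : ∀ {c} → Relation u c → c zero ≡ 0#
      head≡0 {c} rel with c zero Fin.≟ 0#
      ... | yes c₀≡0 = c₀≡0
      ... | no  c₀≢0 = ⊥-elim (u₀∉span (∈span-trans (head-relation⇒∈span c c₀≢0 rel) pivots-span))

    dependent-step : (E : Elimination (tail u)) → u zero ∈span (tail u ∘ Elimination.pivot E) →
                     Elimination u
    dependent-step E u₀∈span = record
      { rank               = rank
      ; nullity            = suc nullity
      ; rank+nullity       = trans (ℕ.+-suc rank nullity) (cong suc rank+nullity)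
      ; pivot              = suc ∘ pivot
      ; pivots-independent = pivots-independent
      ; pivots-span        = λ { zero → u₀∈span ; (suc i) → pivots-span i }
      ; relations          = RelationsExtension.basis u₀≗ relations
      }
      where
      open Elimination E
      u₀≗ = proj₂ (∈span-trans u₀∈span (∈span-member (tail u) ∘ pivot))

  eliminate : ∀ {m M} (u : Fin M → Space (Fin m)) → Elimination u
  eliminate {M = ℕ.zero} u = record
    { rank = 0 ; nullity = 0 ; rank+nullity = refl ; pivot = λ ()
    ; pivots-independent = λ _ _ ()
    ; pivots-span        = λ ()
    ; relations          = record { vec = λ () ; member = λ () ; independent = λ _ _ ()
                                  ; spanning = λ _ → (λ ()) , (λ ()) }
    }
  eliminate {M = suc M} u with eliminate (tail u)
  ... | E with ∈span? (u zero) (tail u ∘ Elimination.pivot E)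
  ...   | yes u₀∈span = dependent-step u E u₀∈span
  ...   | no  u₀∉span = independent-step u E u₀∉span

  record RankNullity {I m} (G : Space I → Space (Fin m)) (M : ℕ) : Set where
    field
      rank nullity : ℕ
      rank+nullity : rank ℕ.+ nullity ≡ M
      image-basis  : Basis (Image G) rank
      kernel-basis : Basis (Kernel G) nullity

  rank-nullity : ∀ {I m M} {G : Space I → Space (Fin m)} → IsLinear G → Basis {I} U M → RankNullity G M
  rank-nullity {G = G} linear B = record
    { rank         = rank
    ; nullity      = nullity
    ; rank+nullity = rank+nullity
    ; image-basis  = record
      { vec         = u ∘ pivot
      ; member      = λ k → b (pivot k) , λ _ → refl
      ; independent = pivots-independent
      ; spanning    = λ (z , Gz≗w) → ∈span-resp Gz≗w (∈span-trans (∈span-homo (spanning tt)) pivots-span)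
      }
    ; kernel-basis = record
      { vec         = kernel-vec
      ; member      = λ t x → trans (lincomb-homo (rel t) b x) (rel-member t x)
      ; independent = λ c combination≗0 → rel-independent c (b-independent _ λ x →
                        trans (sym (lincomb-lincomb c rel b x)) (combination≗0 x))
      ; spanning    = kernel-spanning
      }
    }
    where
    open IsLinear linear
    open Basis B renaming (vec to b; independent to b-independent)
    u = G ∘ b
    open Elimination (eliminate u)
    open Basis relations
      renaming (vec to rel; member to rel-member; independent to rel-independent; spanning to rel-spanning)
    kernel-vec : Fin nullity → Space _
    kernel-vec t = lincomb (rel t) b
    kernel-spanning : ∀ {z} → Kernel G z → z ∈span kernel-vec
    kernel-spanning {z} Gz≗0 = γ , λ x → begin
      z x                          ≡⟨ z≗ x ⟩
      lincomb β b x                ≡⟨ lincomb-congˡ b β≗ x ⟩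
      lincomb (lincomb γ rel) b x  ≡⟨ lincomb-lincomb γ rel b x ⟨
      lincomb γ kernel-vec x       ∎
      where
      β = proj₁ (spanning {z} tt)
      z≗ = proj₂ (spanning {z} tt)
      β-relation : Relation u β
      β-relation x = trans (sym (lincomb-homo β b x)) (trans (sym (≗-cong z≗ x)) (Gz≗0 x))
      γ = proj₁ (rel-spanning β-relation)
      β≗ = proj₂ (rel-spanning β-relation)

  surjective⇒onto : ∀ {I m} {G : Space I → Space (Fin m)} → IsLinear G →
                    (∀ j → Image G (δ j)) → ∀ w → Image G w
  surjective⇒onto {G = G} linear hits w = lincomb w (proj₁ ∘ hits) , λ x → begin
    G (lincomb w (proj₁ ∘ hits)) x ≡⟨ lincomb-homo w (proj₁ ∘ hits) x ⟩
    lincomb w (G ∘ proj₁ ∘ hits) x ≡⟨ lincomb-congʳ w (proj₂ ∘ hits) x ⟩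
    lincomb w δ x                  ≡⟨ ∑-δʳ x w ⟩
    w x                            ∎
    where open IsLinear linear

  surjective⇒rank≡ : ∀ {I m ρ} {G : Space I → Space (Fin m)} → IsLinear G →
                     (∀ j → Image G (δ j)) → Basis (Image G) ρ → ρ ≡ m
  surjective⇒rank≡ linear hits B =
    Basis-unique B (standard-basis _) ((λ _ → tt) , λ {w} _ → surjective⇒onto linear hits w)

  preimage-basis : ∀ {I J κ R} {G : Space I → Space J} → IsLinear G → Basis (Kernel G) κ →
                   {w : Fin R → Space J} → Independent w →
                   (p : Fin R → Space I) → (∀ s → G (p s) ≗ w s) →
                   Basis (λ z → G z ∈span w) (κ ℕ.+ R)
  preimage-basis {κ = κ} {R} {G} linear KB {w} w-independent p Gp≗w = record
    { vec = k ++ p ; member = member′ ; independent = independent′ ; spanning = spanning′ }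
    where
    open IsLinear linear
    open Basis KB
      renaming (vec to k; member to k-member; independent to k-independent; spanning to k-spanning)

    member′ : ∀ i → G ((k ++ p) i) ∈span w
    member′ i with splitAt κ i
    ... | inj₁ t = (λ _ → 0#) , λ x → trans (k-member t x) (sym (lincomb-zeroˡ w x))
    ... | inj₂ s = ∈span-resp (λ x → sym (Gp≗w s x)) (∈span-member w s)

    independent′ : Independent (k ++ p)
    independent′ c c≗0 = ↑-cases cˡ≡0 cʳ≡0
      where
      cˡ = c ∘ (_↑ˡ R)
      cʳ = c ∘ (κ ↑ʳ_)
      split≗0 : lincomb cˡ k +ₛ lincomb cʳ p ≗ 0ₛ
      split≗0 x = trans (sym (lincomb-++ κ c k p x)) (c≗0 x)
      Gk≗0 : G (lincomb cˡ k) ≗ 0ₛ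
      Gk≗0 x = trans (lincomb-homo cˡ k x) (lincomb-zeroʳ cˡ k-member x)
      cʳ≡0 : ∀ s → cʳ s ≡ 0#
      cʳ≡0 = w-independent cʳ λ y → begin
        lincomb cʳ w y                           ≡⟨ lincomb-congʳ cʳ Gp≗w y ⟨
        lincomb cʳ (G ∘ p) y                     ≡⟨ lincomb-homo cʳ p y ⟨
        G (lincomb cʳ p) y                       ≡⟨ +-identityˡ _ ⟨
        0# + G (lincomb cʳ p) y                  ≡⟨ cong (_+ G (lincomb cʳ p) y) (Gk≗0 y) ⟨
        G (lincomb cˡ k) y + G (lincomb cʳ p) y  ≡⟨ +-homo (lincomb cˡ k) (lincomb cʳ p) y ⟨
        G (lincomb cˡ k +ₛ lincomb cʳ p) y       ≡⟨ ≗-cong split≗0 y ⟩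
        G 0ₛ y                                   ≡⟨ 0-homo y ⟩
        0#                                       ∎
      cˡ≡0 : ∀ t → cˡ t ≡ 0#
      cˡ≡0 = k-independent cˡ λ x → begin
        lincomb cˡ k x                   ≡⟨ +-identityʳ _ ⟨
        lincomb cˡ k x + 0#              ≡⟨ cong (lincomb cˡ k x +_) (trans (lincomb-congˡ p cʳ≡0 x) (lincomb-zeroˡ p x)) ⟨
        lincomb cˡ k x + lincomb cʳ p x  ≡⟨ split≗0 x ⟩
        0#                               ∎

    spanning′ : ∀ {z} → G z ∈span w → z ∈span (k ++ p)
    spanning′ {z} (β , Gz≗) = γ ++ β , λ x → begin
      z x
        ≡⟨ x-y+y≡x (z x) (lincomb β p x) ⟨
      (z -ₛ lincomb β p) x + lincomb β p x
        ≡⟨ cong (_+ lincomb β p x) (z′≗ x) ⟩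
      lincomb γ k x + lincomb β p x
        ≡⟨ cong₂ _+_ (lincomb-congˡ k (lookup-++ˡ γ β) x) (lincomb-congˡ p (lookup-++ʳ γ β) x) ⟨
      lincomb ((γ ++ β) ∘ (_↑ˡ R)) k x + lincomb ((γ ++ β) ∘ (κ ↑ʳ_)) p x
        ≡⟨ lincomb-++ κ (γ ++ β) k p x ⟨
      lincomb (γ ++ β) (k ++ p) x
        ∎
      where
      z′-kernel : Kernel G (z -ₛ lincomb β p)
      z′-kernel y = begin
        G (z -ₛ lincomb β p) y                 ≡⟨ -‿homo z (lincomb β p) y ⟩
        G z y + - G (lincomb β p) y            ≡⟨ cong₂ (λ a b → a + - b) (Gz≗ y) (lincomb-homo β p y) ⟩
        lincomb β w y + - lincomb β (G ∘ p) y  ≡⟨ cong (λ a → _ + - a) (lincomb-congʳ β Gp≗w y) ⟩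
        lincomb β w y + - lincomb β w y        ≡⟨ -‿inverseʳ _ ⟩
        0#                                     ∎
      γ = proj₁ (k-spanning z′-kernel)
      z′≗ = proj₂ (k-spanning z′-kernel)

module CoordinateSpace {q : ℕ} (F : FiniteField q) where

  open FiniteField F
  open LinAlg F
  open LinearAlgebra F
  open ≡-Reasoning

  enum : ∀ k → Fin (q ℕ.^ k) → Vecr k
  enum ℕ.zero  _ = Vec.[]
  enum (suc k) i = uncurry (λ c j → c Vec.∷ enum k j) (Fin.remQuot (q ℕ.^ k) i)

  index : ∀ k → Vecr k → Fin (q ℕ.^ k)
  index ℕ.zero  Vec.[]      = zero
  index (suc k) (c Vec.∷ v) = Fin.combine c (index k v)

  enum-combine : ∀ k c j → enum (suc k) (Fin.combine c j) ≡ c Vec.∷ enum k j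
  enum-combine k c j = cong (uncurry (λ c j → c Vec.∷ enum k j)) (Fin.remQuot-combine c j)

  enum-index : ∀ k v → enum k (index k v) ≡ v
  enum-index ℕ.zero  Vec.[]      = refl
  enum-index (suc k) (c Vec.∷ v) =
    trans (enum-combine k c (index k v)) (cong (c Vec.∷_) (enum-index k v))

  index-enum : ∀ k i → index k (enum k i) ≡ i
  index-enum ℕ.zero  zero = refl
  index-enum (suc k) i    =
    trans (cong (Fin.combine c) (index-enum k j)) (Fin.combine-remQuot {q} (q ℕ.^ k) i)
    where
    c = proj₁ (Fin.remQuot {q} (q ℕ.^ k) i)
    j = proj₂ (Fin.remQuot {q} (q ℕ.^ k) i)

  enumeration : ∀ k → Fin (q ℕ.^ k) ↔ Vecr k
  enumeration k = mk↔ₛ′ (enum k) (index k) (enum-index k) (index-enum k)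

  ∑-allVecs : ∀ k (f : Vecr k → K) → sumK (allVecs k) f ≡ ∑[ i < q ℕ.^ k ] f (enum k i)
  ∑-allVecs ℕ.zero  f = refl
  ∑-allVecs (suc k) f = begin
    sumK (List.concatMap (λ c → List.map (c Vec.∷_) (allVecs k)) allK) f
      ≡⟨ sumK-concatMap _ allK f ⟩
    sumFin (λ c → sumK (List.map (c Vec.∷_) (allVecs k)) f)
      ≡⟨ sumFin≡∑ (λ c → sumK (List.map (c Vec.∷_) (allVecs k)) f) ⟩
    ∑[ c < q ] sumK (List.map (c Vec.∷_) (allVecs k)) f
      ≡⟨ sum-cong-≗ (λ c → List.foldr-map _ (c Vec.∷_) 0# (allVecs k)) ⟩
    ∑[ c < q ] sumK (allVecs k) (f ∘ (c Vec.∷_))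
      ≡⟨ sum-cong-≗ (λ c → ∑-allVecs k (f ∘ (c Vec.∷_))) ⟩
    ∑[ c < q ] ∑[ j < q ℕ.^ k ] f (c Vec.∷ enum k j)
      ≡⟨ sum-cong-≗ (λ c → sum-cong-≗ (λ j → cong f (sym (enum-combine k c j)))) ⟩
    ∑[ c < q ] ∑[ j < q ℕ.^ k ] f (enum (suc k) (Fin.combine c j))
      ≡⟨ sym (∑-combine q (q ℕ.^ k) (f ∘ enum (suc k))) ⟩
    ∑[ i < q ℕ.^ suc k ] f (enum (suc k) i) ∎

  lookup-sumV : ∀ {A : Set} {k} (xs : List.List A) (f : A → Vecr k) i →
                lookup (sumV xs f) i ≡ sumK xs (λ a → lookup (f a) i)
  lookup-sumV List.[]       f i = Vec.lookup-replicate i 0#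
  lookup-sumV (x List.∷ xs) f i =
    trans (Vec.lookup-zipWith _+_ i (f x) (sumV xs f)) (cong (lookup (f x) i +_) (lookup-sumV xs f i))

  lookup-injective : ∀ {k} {u v : Vecr k} → (∀ i → lookup u i ≡ lookup v i) → u ≡ v
  lookup-injective {u = u} {v} u≗v =
    trans (sym (Vec.tabulate∘lookup u)) (trans (Vec.tabulate-cong u≗v) (Vec.tabulate∘lookup v))

  unit : ∀ {k} → Fin k → Vecr k
  unit i = Vec.tabulate (δ i)

  unit≢zeroV : ∀ {k} (i : Fin k) → unit i ≢ zeroV
  unit≢zeroV i unit≡0 = 0≢1 (begin
    0#                 ≡⟨ Vec.lookup-replicate i 0# ⟨
    lookup zeroV i     ≡⟨ cong (λ v → lookup v i) unit≡0 ⟨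
    lookup (unit i) i  ≡⟨ Vec.lookup∘tabulate (δ i) i ⟩
    δ i i              ≡⟨ δ-diag Fin._≟_ i ⟩
    1#                 ∎)

module Construction {q : ℕ} (F : FiniteField q) {r n : ℕ} (H : Fin n → LinAlg.Vecr F r)
                    (τ : LinAlg.Vecr F r ↔ LinAlg.Vecr F r) where

  open FiniteField F
  open LinAlg F
  open Codes r n H
  open LinearAlgebra F
  open CoordinateSpace F
  open Inverse τ using (to; from; strictlyInverseˡ; strictlyInverseʳ)
  open ≡-Reasoning

  Q : ℕ
  Q = q ℕ.^ r

  positions : Basis {Pos} U Q
  positions = enumeration-basis (enumeration r)

  coordinates : Basis {Fin n ⊎ Pos} U (n ℕ.+ Q)
  coordinates = enumeration-basis (↔-trans Fin.+↔⊎ (↔-refl ⊎-↔ enumeration r))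

  e≡δ : ∀ a b → e a b ≡ δ⟨ _≟v_ ⟩ a b
  e≡δ a b with a ≟v b
  ... | yes _ = refl
  ... | no  _ = refl

  e-to : ∀ a b → e (to a) (to b) ≡ e a b
  e-to a b = begin
    e (to a) (to b)          ≡⟨ e≡δ (to a) (to b) ⟩
    δ⟨ _≟v_ ⟩ (to a) (to b)  ≡⟨ δ-injective _≟v_ _≟v_ (Injection.injective (↔⇒↣ τ)) a b ⟩
    δ⟨ _≟v_ ⟩ a b            ≡⟨ e≡δ a b ⟨
    e a b                    ∎

  e-enum : ∀ k b → e (enum r k) b ≡ δ k (index r b)
  e-enum k b = begin
    e (enum r k) b                             ≡⟨ cong (e (enum r k)) (enum-index r b) ⟨
    e (enum r k) (enum r (index r b))          ≡⟨ e≡δ (enum r k) (enum r (index r b)) ⟩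
    δ⟨ _≟v_ ⟩ (enum r k) (enum r (index r b))  ≡⟨ δ-injective _≟v_ Fin._≟_ enum-injective k _ ⟩
    δ k (index r b)                            ∎
    where enum-injective = Injection.injective (↔⇒↣ (enumeration r))

  lincomb-e : ∀ {J} b (A : Fin Q → Space J) → lincomb (e b ∘ enum r) A ≗ A (index r b)
  lincomb-e b A x = begin
    ∑[ k < Q ] (e b (enum r k) * A k x)
      ≡⟨ sum-cong-≗ (λ k → cong (λ a → e a (enum r k) * A k x) (enum-index r b)) ⟨
    ∑[ k < Q ] (e (enum r (index r b)) (enum r k) * A k x)
      ≡⟨ sum-cong-≗ (λ k → cong (_* A k x) (e-enum (index r b) (enum r k))) ⟩
    ∑[ k < Q ] (δ (index r b) (index r (enum r k)) * A k x)
      ≡⟨ sum-cong-≗ (λ k → cong (λ j → δ (index r b) j * A k x) (index-enum r k)) ⟩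
    ∑[ k < Q ] (δ (index r b) k * A k x)
      ≡⟨ ∑-δˡ (index r b) (λ k → A k x) ⟩
    A (index r b) x
      ∎

  ∑-τ-invariant : ∀ (g : Pos → K) → ∑[ k < Q ] g (to (enum r k)) ≡ ∑[ k < Q ] g (enum r k)
  ∑-τ-invariant g = begin
    ∑[ k < Q ] g (to (enum r k))                   ≡⟨ sum-cong-≗ (cong g ∘ enum-index r ∘ to ∘ enum r) ⟨
    ∑[ k < Q ] g (enum r (π Permutation.⟨$⟩ʳ k))  ≡⟨ ∑-permute (g ∘ enum r) π ⟨
    ∑[ k < Q ] g (enum r k)                        ∎
    where
    π : Permutation.Permutation Q Q
    π = ↔-trans (enumeration r) (↔-trans τ (↔-sym (enumeration r)))

  -- The check map of D

  checkD : Space Pos → Space (Fin (suc r))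
  checkD y = lincomb (y ∘ enum r) (λ k → 1# ∷ lookup (enum r k))

  checkD-linear : IsLinear checkD
  checkD-linear = lincomb-linear (enum r) (λ k → 1# ∷ lookup (enum r k))

  checkD-e : ∀ b → checkD (e b) ≗ 1# ∷ lookup b
  checkD-e b x = trans (lincomb-e b (λ k → 1# ∷ lookup (enum r k)) x)
                       (cong (λ v → (1# ∷ lookup v) x) (enum-index r b))

  sumK≡checkD : ∀ y → sumK (allVecs r) y ≡ checkD y zero
  sumK≡checkD y = trans (∑-allVecs r y) (sum-cong-≗ (λ k → sym (*-identityʳ (y (enum r k)))))

  sumV≡checkD : ∀ y i → lookup (sumV (allVecs r) (λ a → y a ·v a)) i ≡ checkD y (suc i)
  sumV≡checkD y i = begin
    lookup (sumV (allVecs r) (λ a → y a ·v a)) i    ≡⟨ lookup-sumV (allVecs r) (λ a → y a ·v a) i ⟩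
    sumK (allVecs r) (λ a → lookup (y a ·v a) i)    ≡⟨ ∑-allVecs r (λ a → lookup (y a ·v a) i) ⟩
    ∑[ k < Q ] lookup (y (enum r k) ·v enum r k) i  ≡⟨ sum-cong-≗ (λ k → Vec.lookup-map i _ (enum r k)) ⟩
    checkD y (suc i)                                ∎

  D⇒Kernel : D ⊆ Kernel checkD
  D⇒Kernel {y} (sum≡0 , moment≡0) zero    = trans (sym (sumK≡checkD y)) sum≡0
  D⇒Kernel {y} (sum≡0 , moment≡0) (suc i) =
    trans (sym (sumV≡checkD y i)) (trans (cong (λ v → lookup v i) moment≡0) (Vec.lookup-replicate i 0#))

  Kernel⇒D : Kernel checkD ⊆ D
  Kernel⇒D {y} checkDy≗0 = trans (sumK≡checkD y) (checkDy≗0 zero) , lookup-injective λ i →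
    trans (sumV≡checkD y i) (trans (checkDy≗0 (suc i)) (sym (Vec.lookup-replicate i 0#)))

  Da-value : Pos → Space (Fin (suc r))
  Da-value b = 0# ∷ (λ i → - lookup b i)

  checkD-shift : ∀ b y → checkD (λ c → y c + - e zeroV c + e b c) ≗ checkD y -ₛ Da-value b
  checkD-shift b y x = begin
    checkD (y -ₛ e zeroV +ₛ e b) x                            ≡⟨ +-homo (y -ₛ e zeroV) (e b) x ⟩
    checkD (y -ₛ e zeroV) x + checkD (e b) x                  ≡⟨ cong (_+ _) (-‿homo y (e zeroV) x) ⟩
    checkD y x + - checkD (e zeroV) x + checkD (e b) x
      ≡⟨ cong₂ (λ s t → checkD y x + - s + t) (checkD-e zeroV x) (checkD-e b x) ⟩
    checkD y x + - (1# ∷ lookup zeroV) x + (1# ∷ lookup b) x  ≡⟨ shift x ⟩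
    checkD y x + - Da-value b x                               ∎
    where
    open IsLinear checkD-linear
    shift : ∀ x → checkD y x + - (1# ∷ lookup zeroV) x + (1# ∷ lookup b) x ≡ checkD y x + - Da-value b x
    shift zero = begin
      checkD y zero + - 1# + 1#  ≡⟨ x-y+y≡x (checkD y zero) 1# ⟩
      checkD y zero              ≡⟨ +-identityʳ _ ⟨
      checkD y zero + 0#         ≡⟨ cong (checkD y zero +_) -0#≈0# ⟨
      checkD y zero + - 0#       ∎
    shift (suc i) = begin
      g + - lookup zeroV i + lookup b i  ≡⟨ cong (λ t → g + - t + lookup b i) (Vec.lookup-replicate i 0#) ⟩
      g + - 0# + lookup b i              ≡⟨ cong (λ t → g + t + lookup b i) -0#≈0# ⟩
      g + 0# + lookup b i                ≡⟨ cong (_+ lookup b i) (+-identityʳ g) ⟩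
      g + lookup b i                     ≡⟨ cong (g +_) (-‿involutive (lookup b i)) ⟨
      g + - - lookup b i                 ∎
      where g = checkD y (suc i)

  Da⇒checkD≗ : ∀ {b y} → Da b y → checkD y ≗ Da-value b
  Da⇒checkD≗ {b} {y} Da-y x = x∙y⁻¹≈ε⇒x≈y _ _ (trans (sym (checkD-shift b y x)) (D⇒Kernel Da-y x))

  checkD≗⇒Da : ∀ {b y} → checkD y ≗ Da-value b → Da b y
  checkD≗⇒Da {b} {y} checkDy≗ =
    Kernel⇒D (λ x → trans (checkD-shift b y x) (x≈y⇒x∙y⁻¹≈ε (checkDy≗ x)))

  checkD-surjective : ∀ j → Image checkD (δ j)
  checkD-surjective zero = e zeroV , λ x → trans (checkD-e zeroV x) (hit x)
    where
    hit : ∀ x → (1# ∷ lookup zeroV) x ≡ δ zero x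
    hit zero    = sym (δ-diag Fin._≟_ (zero {r}))
    hit (suc i) = trans (Vec.lookup-replicate i 0#) (sym (δ-off Fin._≟_ {zero} {suc i} λ ()))
  checkD-surjective (suc i) = e (unit i) -ₛ e zeroV , λ x → begin
    checkD (e (unit i) -ₛ e zeroV) x
      ≡⟨ IsLinear.-‿homo checkD-linear (e (unit i)) (e zeroV) x ⟩
    checkD (e (unit i)) x + - checkD (e zeroV) x
      ≡⟨ cong₂ (λ s t → s + - t) (checkD-e (unit i) x) (checkD-e zeroV x) ⟩
    (1# ∷ lookup (unit i)) x + - (1# ∷ lookup zeroV) x
      ≡⟨ hit x ⟩
    δ (suc i) x
      ∎
    where
    hit : ∀ x → (1# ∷ lookup (unit i)) x + - (1# ∷ lookup zeroV) x ≡ δ (suc i) x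
    hit zero    = trans (-‿inverseʳ 1#) (sym (δ-off Fin._≟_ {suc i} {zero} λ ()))
    hit (suc j) = begin
      lookup (unit i) j + - lookup zeroV j
        ≡⟨ cong₂ (λ s t → s + - t) (Vec.lookup∘tabulate (δ i) j) (Vec.lookup-replicate j 0#) ⟩
      δ i j + - 0#       ≡⟨ cong (δ i j +_) -0#≈0# ⟩
      δ i j + 0#         ≡⟨ +-identityʳ (δ i j) ⟩
      δ i j              ≡⟨ δ-injective Fin._≟_ Fin._≟_ Fin.suc-injective i j ⟨
      δ (suc i) (suc j)  ∎

  -- The syndrome map of S_τ

  checkC : Space (Fin n) → Space (Fin r)
  checkC x = lincomb x (lookup ∘ H)

  checkC-linear : IsLinear checkC
  checkC-linear = lincomb-linear id (lookup ∘ H)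

  syndrome≡checkC : ∀ x i → lookup (syndrome x) i ≡ checkC x i
  syndrome≡checkC x i = begin
    lookup (syndrome x) i                 ≡⟨ lookup-sumV (List.allFin n) (λ j → x j ·v H j) i ⟩
    sumFin (λ j → lookup (x j ·v H j) i)  ≡⟨ sumFin≡∑ (λ j → lookup (x j ·v H j) i) ⟩
    ∑[ j < n ] lookup (x j ·v H j) i      ≡⟨ sum-cong-≗ (λ j → Vec.lookup-map i (x j *_) (H j)) ⟩
    checkC x i                            ∎

  Ca⇒checkC≗ : ∀ {a x} → Ca a x → checkC x ≗ lookup a
  Ca⇒checkC≗ {x = x} Ca-x i = trans (sym (syndrome≡checkC x i)) (cong (λ v → lookup v i) Ca-x)

  checkC≗⇒Ca : ∀ {a x} → checkC x ≗ lookup a → Ca a x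
  checkC≗⇒Ca {x = x} checkCx≗ = lookup-injective (λ i → trans (syndrome≡checkC x i) (checkCx≗ i))

  checkC-hits-unit : IsHammingCheck r n H → ∀ i → Image checkC (δ i)
  checkC-hits-unit (_ , multiple-of-column , _) i = (λ j → c * δ j′ j) , λ t → begin
    ∑[ j < n ] (c * δ j′ j * lookup (H j) t)    ≡⟨ sum-cong-≗ (λ j → *-assoc c (δ j′ j) _) ⟩
    ∑[ j < n ] (c * (δ j′ j * lookup (H j) t))  ≡⟨ *-distribˡ-sum c (λ j → δ j′ j * lookup (H j) t) ⟨
    c * ∑[ j < n ] (δ j′ j * lookup (H j) t)    ≡⟨ cong (c *_) (∑-δˡ j′ (λ j → lookup (H j) t)) ⟩
    c * lookup (H j′) t                         ≡⟨ Vec.lookup-map t (c *_) (H j′) ⟨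
    lookup (c ·v H j′) t                        ≡⟨ cong (λ v → lookup v t) unit≡c·H ⟨
    lookup (unit i) t                           ≡⟨ Vec.lookup∘tabulate (δ i) t ⟩
    δ i t                                       ∎
    where
    j′ = proj₁ (multiple-of-column (unit i) (unit≢zeroV i))
    c  = proj₁ (proj₂ (multiple-of-column (unit i) (unit≢zeroV i)))
    unit≡c·H = proj₂ (proj₂ (multiple-of-column (unit i) (unit≢zeroV i)))

  checkS : Space (Fin n ⊎ Pos) → Space (Fin (r ℕ.+ suc r))
  checkS z = checkC (z ∘ inj₁) ++ checkD (z ∘ inj₂)

  checkS-linear : IsLinear checkS
  checkS-linear = ++-linear (lincomb-linear inj₁ (lookup ∘ H))
                            (lincomb-linear (inj₂ ∘ enum r) (λ k → 1# ∷ lookup (enum r k)))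

  -- checkS is constant, equal to T a, on the piece C_a × D_(τ a) of S_τ.
  T : Pos → Space (Fin (r ℕ.+ suc r))
  T a = lookup a ++ Da-value (to a)

  T-zero : to zeroV ≡ zeroV → T zeroV ≗ 0ₛ
  T-zero τ0 i with splitAt r i
  ... | inj₁ j       = Vec.lookup-replicate j 0#
  ... | inj₂ zero    = refl
  ... | inj₂ (suc j) = begin
    - lookup (to zeroV) j  ≡⟨ cong (λ v → - lookup v j) τ0 ⟩
    - lookup zeroV j       ≡⟨ cong -_ (Vec.lookup-replicate j 0#) ⟩
    - 0#                   ≡⟨ -0#≈0# ⟩
    0#                     ∎

  Sτ⇒checkS≗T : ∀ {z} → Sτ τ z → Σ[ a ∈ Pos ] checkS z ≗ T a
  Sτ⇒checkS≗T {z} (a , x , y , Ca-x , Da-y , z≗xy) = a , checkSz≗Ta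
    where
    checkSz≗Ta : checkS z ≗ T a
    checkSz≗Ta i with splitAt r i
    ... | inj₁ j = trans (IsLinear.≗-cong checkC-linear (z≗xy ∘ inj₁) j) (Ca⇒checkC≗ Ca-x j)
    ... | inj₂ j = trans (IsLinear.≗-cong checkD-linear (z≗xy ∘ inj₂) j) (Da⇒checkD≗ {to a} Da-y j)

  checkS≗T⇒Sτ : ∀ {z} a → checkS z ≗ T a → Sτ τ z
  checkS≗T⇒Sτ {z} a checkSz≗Ta =
    a , z ∘ inj₁ , z ∘ inj₂ , checkC≗⇒Ca left , checkD≗⇒Da {to a} right ,
    λ { (inj₁ _) → refl ; (inj₂ _) → refl }
    where
    left : checkC (z ∘ inj₁) ≗ lookup a
    left j = begin
      checkC (z ∘ inj₁) j     ≡⟨ lookup-++ˡ (checkC (z ∘ inj₁)) (checkD (z ∘ inj₂)) j ⟨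
      checkS z (j ↑ˡ suc r)   ≡⟨ checkSz≗Ta (j ↑ˡ suc r) ⟩
      T a (j ↑ˡ suc r)        ≡⟨ lookup-++ˡ (lookup a) (Da-value (to a)) j ⟩
      lookup a j              ∎
    right : checkD (z ∘ inj₂) ≗ Da-value (to a)
    right j = begin
      checkD (z ∘ inj₂) j     ≡⟨ lookup-++ʳ (checkC (z ∘ inj₁)) (checkD (z ∘ inj₂)) j ⟨
      checkS z (r ↑ʳ j)       ≡⟨ checkSz≗Ta (r ↑ʳ j) ⟩
      T a (r ↑ʳ j)            ≡⟨ lookup-++ʳ (lookup a) (Da-value (to a)) j ⟩
      Da-value (to a) j       ∎

  checkS-hits-C : IsHammingCheck r n H → ∀ i → Image checkS (δ (i ↑ˡ suc r))
  checkS-hits-C hamming i = concat x 0ₛ , ↑-cases left right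
    where
    x = proj₁ (checkC-hits-unit hamming i)
    left : ∀ t → checkS (concat x 0ₛ) (t ↑ˡ suc r) ≡ δ (i ↑ˡ suc r) (t ↑ˡ suc r)
    left t = begin
      checkS (concat x 0ₛ) (t ↑ˡ suc r)  ≡⟨ lookup-++ˡ (checkC x) (checkD 0ₛ) t ⟩
      checkC x t                         ≡⟨ proj₂ (checkC-hits-unit hamming i) t ⟩
      δ i t                              ≡⟨ δ-injective Fin._≟_ Fin._≟_ (Fin.↑ˡ-injective _ _ _) i t ⟨
      δ (i ↑ˡ suc r) (t ↑ˡ suc r)        ∎
    right : ∀ s → checkS (concat x 0ₛ) (r ↑ʳ s) ≡ δ (i ↑ˡ suc r) (r ↑ʳ s)
    right s = begin
      checkS (concat x 0ₛ) (r ↑ʳ s)  ≡⟨ lookup-++ʳ (checkC x) (checkD 0ₛ) s ⟩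
      checkD 0ₛ s                    ≡⟨ IsLinear.0-homo checkD-linear s ⟩
      0#                             ≡⟨ δ-off Fin._≟_ (↑ˡ≢↑ʳ i s) ⟨
      δ (i ↑ˡ suc r) (r ↑ʳ s)        ∎

  checkS-hits-D : ∀ s → Image checkS (δ (r ↑ʳ s))
  checkS-hits-D s = concat 0ₛ y , ↑-cases left right
    where
    y = proj₁ (checkD-surjective s)
    left : ∀ t → checkS (concat 0ₛ y) (t ↑ˡ suc r) ≡ δ (r ↑ʳ s) (t ↑ˡ suc r)
    left t = begin
      checkS (concat 0ₛ y) (t ↑ˡ suc r)  ≡⟨ lookup-++ˡ (checkC 0ₛ) (checkD y) t ⟩
      checkC 0ₛ t                        ≡⟨ IsLinear.0-homo checkC-linear t ⟩
      0#                                 ≡⟨ δ-off Fin._≟_ (↑ˡ≢↑ʳ t s ∘ sym) ⟨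
      δ (r ↑ʳ s) (t ↑ˡ suc r)            ∎
    right : ∀ s′ → checkS (concat 0ₛ y) (r ↑ʳ s′) ≡ δ (r ↑ʳ s) (r ↑ʳ s′)
    right s′ = begin
      checkS (concat 0ₛ y) (r ↑ʳ s′)  ≡⟨ lookup-++ʳ (checkC 0ₛ) (checkD y) s′ ⟩
      checkD y s′                     ≡⟨ proj₂ (checkD-surjective s) s′ ⟩
      δ s s′                          ≡⟨ δ-injective Fin._≟_ Fin._≟_ (Fin.↑ʳ-injective r _ _) s s′ ⟨
      δ (r ↑ʳ s) (r ↑ʳ s′)            ∎

  checkS-surjective : IsHammingCheck r n H → ∀ j → Image checkS (δ j)
  checkS-surjective hamming = ↑-cases {P = Image checkS ∘ δ} (checkS-hits-C hamming) checkS-hits-D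

  -- The check map of D ∩ τ(D)

  -- The moments of y ∘ τ are negated so that check∩ (e (τ a)) = E - T a.
  check∩ˡ : Space Pos → Space (Fin r)
  check∩ˡ y = lincomb (y ∘ to ∘ enum r) (λ k i → - lookup (enum r k) i)

  check∩ : Space Pos → Space (Fin (r ℕ.+ suc r))
  check∩ y = check∩ˡ y ++ checkD y

  check∩-linear : IsLinear check∩
  check∩-linear = ++-linear (lincomb-linear (to ∘ enum r) (λ k i → - lookup (enum r k) i)) checkD-linear

  check∩ˡ≡-checkD : ∀ y i → check∩ˡ y i ≡ - checkD (y ∘ to) (suc i)
  check∩ˡ≡-checkD y i = begin
    ∑[ k < Q ] (y (to (enum r k)) * - lookup (enum r k) i)
      ≡⟨ sum-cong-≗ (λ k → sym (-‿distribʳ-* (y (to (enum r k))) (lookup (enum r k) i))) ⟩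
    ∑[ k < Q ] (- (y (to (enum r k)) * lookup (enum r k) i))
      ≡⟨ ∑-neg (λ k → y (to (enum r k)) * lookup (enum r k) i) ⟩
    - checkD (y ∘ to) (suc i)
      ∎

  ∩⇒Kernel : ∀ {y} → D y × τD τ y → Kernel check∩ y
  ∩⇒Kernel {y} (Dy , y′ , Dy′ , y≗τy′) i with splitAt r i
  ... | inj₁ j = begin
      check∩ˡ y j                ≡⟨ check∩ˡ≡-checkD y j ⟩
      - checkD (y ∘ to) (suc j)  ≡⟨ cong -_ (IsLinear.≗-cong checkD-linear y∘to≗y′ (suc j)) ⟩
      - checkD y′ (suc j)        ≡⟨ cong -_ (D⇒Kernel Dy′ (suc j)) ⟩
      - 0#                       ≡⟨ -0#≈0# ⟩
      0#                         ∎
    where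
    y∘to≗y′ : y ∘ to ≗ y′
    y∘to≗y′ a = trans (y≗τy′ (to a)) (cong y′ (strictlyInverseʳ a))
  ... | inj₂ j = D⇒Kernel Dy j

  Kernel⇒∩ : ∀ {y} → Kernel check∩ y → D y × τD τ y
  Kernel⇒∩ {y} check∩y≗0 =
    Kernel⇒D checkDy≗0 , y ∘ to , Kernel⇒D checkD[y∘to]≗0 , λ b → cong y (sym (strictlyInverseˡ b))
    where
    checkDy≗0 : Kernel checkD y
    checkDy≗0 j = trans (sym (lookup-++ʳ (check∩ˡ y) (checkD y) j)) (check∩y≗0 (r ↑ʳ j))
    checkD[y∘to]≗0 : Kernel checkD (y ∘ to)
    checkD[y∘to]≗0 zero    = trans (∑-τ-invariant (λ b → y b * 1#)) (checkDy≗0 zero)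
    checkD[y∘to]≗0 (suc j) = -‿injective (begin
      - checkD (y ∘ to) (suc j)  ≡⟨ check∩ˡ≡-checkD y j ⟨
      check∩ˡ y j                ≡⟨ lookup-++ˡ (check∩ˡ y) (checkD y) j ⟨
      check∩ y (j ↑ˡ suc r)      ≡⟨ check∩y≗0 (j ↑ˡ suc r) ⟩
      0#                         ≡⟨ -0#≈0# ⟨
      - 0#                       ∎)

  E : Space (Fin (r ℕ.+ suc r))
  E = 0ₛ ++ (1# ∷ 0ₛ)

  check∩-e-to : ∀ a → check∩ (e (to a)) ≗ E -ₛ T a
  check∩-e-to a i with splitAt r i
  ... | inj₁ j = begin
      lincomb (e (to a) ∘ to ∘ enum r) A j  ≡⟨ lincomb-congˡ A (λ k → e-to a (enum r k)) j ⟩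
      lincomb (e a ∘ enum r) A j            ≡⟨ lincomb-e a A j ⟩
      - lookup (enum r (index r a)) j       ≡⟨ cong (λ v → - lookup v j) (enum-index r a) ⟩
      - lookup a j                          ≡⟨ +-identityˡ _ ⟨
      0# + - lookup a j                     ∎
    where
    A : Fin Q → Space (Fin r)
    A k i = - lookup (enum r k) i
  ... | inj₂ zero    = trans (checkD-e (to a) zero) (sym (trans (cong (1# +_) -0#≈0#) (+-identityʳ 1#)))
  ... | inj₂ (suc j) = trans (checkD-e (to a) (suc j)) (sym (trans (+-identityˡ _) (-‿involutive _)))

  module RN-D = RankNullity (rank-nullity checkD-linear positions)
  module RN-∩ = RankNullity (rank-nullity check∩-linear positions)
  module RN-S = RankNullity (rank-nullity checkS-linear coordinates)
  module ElimT = Elimination (eliminate (T ∘ enum r))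

  R : ℕ
  R = ElimT.rank

  T-basis : Fin R → Space (Fin (r ℕ.+ suc r))
  T-basis = T ∘ enum r ∘ ElimT.pivot

  T∈span : ∀ a → T a ∈span T-basis
  T∈span a = ∈span-resp (λ x → cong (λ b → T b x) (enum-index r a)) (ElimT.pivots-span (index r a))

  E∷T-basis : Fin (suc R) → Space (Fin (r ℕ.+ suc r))
  E∷T-basis = E ∷ T-basis

  E-T∈span : ∀ a → E -ₛ T a ∈span E∷T-basis
  E-T∈span a = ∈span-resp {v = E∷T-basis} (λ x → cong (E x +_) (-1*x≈-x (T a x)))
    (∈span-+ {v = E∷T-basis} (∈span-member E∷T-basis zero)
                             (∈span-· {v = E∷T-basis} (- 1#) (∈span-∷ {v = T-basis} E (T∈span a))))

  check∩-e-to-zero : to zeroV ≡ zeroV → check∩ (e (to zeroV)) ≗ E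
  check∩-e-to-zero τ0 x = begin
    check∩ (e (to zeroV)) x  ≡⟨ check∩-e-to zeroV x ⟩
    E x + - T zeroV x        ≡⟨ cong (λ t → E x + - t) (T-zero τ0 x) ⟩
    E x + - 0#               ≡⟨ cong (E x +_) -0#≈0# ⟩
    E x + 0#                 ≡⟨ +-identityʳ (E x) ⟩
    E x                      ∎

  check∩-difference : to zeroV ≡ zeroV → ∀ a → check∩ (e (to zeroV) -ₛ e (to a)) ≗ T a
  check∩-difference τ0 a x = begin
    check∩ (e (to zeroV) -ₛ e (to a)) x
      ≡⟨ IsLinear.-‿homo check∩-linear (e (to zeroV)) (e (to a)) x ⟩
    check∩ (e (to zeroV)) x + - check∩ (e (to a)) x
      ≡⟨ cong₂ (λ s t → s + - t) (check∩-e-to-zero τ0 x) (check∩-e-to a x) ⟩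
    E x + - (E x + - T a x)
      ≡⟨ x-[x-y]≡y (E x) (T a x) ⟩
    T a x
      ∎

  check∩-position∈span : ∀ k → check∩ (Basis.vec positions k) ∈span E∷T-basis
  check∩-position∈span k = ∈span-resp {v = E∷T-basis} E-T≗check∩ (E-T∈span (from (enum r k)))
    where
    E-T≗check∩ : E -ₛ T (from (enum r k)) ≗ check∩ (Basis.vec positions k)
    E-T≗check∩ x = begin
      (E -ₛ T (from (enum r k))) x         ≡⟨ check∩-e-to (from (enum r k)) x ⟨
      check∩ (e (to (from (enum r k)))) x  ≡⟨ cong (λ b → check∩ (e b) x) (strictlyInverseˡ (enum r k)) ⟩
      check∩ (e (enum r k)) x              ≡⟨ IsLinear.≗-cong check∩-linear (e-enum k) x ⟩
      check∩ (Basis.vec positions k) x     ∎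

  E∷T-independent : Independent E∷T-basis
  E∷T-independent c rel = λ
    { zero    → c₀≡0
    ; (suc s) → ElimT.pivots-independent (tail c) (tail-relation c c₀≡0 rel) s }
    where
    T-vanishes : ∀ s → c (suc s) * T-basis s (r ↑ʳ zero) ≡ 0#
    T-vanishes s = trans (cong (c (suc s) *_) (lookup-++ʳ (lookup a) (Da-value (to a)) zero)) (zeroʳ (c (suc s)))
      where a = enum r (ElimT.pivot s)
    c₀≡0 : c zero ≡ 0#
    c₀≡0 = begin
      c zero                                                         ≡⟨ *-identityʳ (c zero) ⟨
      c zero * 1#                                                    ≡⟨ +-identityʳ _ ⟨
      c zero * 1# + 0#
        ≡⟨ cong₂ (λ s t → c zero * s + t) (lookup-++ʳ (0ₛ {Fin r}) _ zero) (∑-zero T-vanishes) ⟨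
      c zero * E (r ↑ʳ zero) + lincomb (tail c) T-basis (r ↑ʳ zero)  ≡⟨ rel (r ↑ʳ zero) ⟩
      0#                                                             ∎

  check∩-image-basis : to zeroV ≡ zeroV → Basis (Image check∩) (suc R)
  check∩-image-basis τ0 = record
    { vec         = E∷T-basis
    ; member      = λ { zero    → e (to zeroV) , check∩-e-to-zero τ0
                      ; (suc s) → e (to zeroV) -ₛ e (to (enum r (ElimT.pivot s))) ,
                                  check∩-difference τ0 (enum r (ElimT.pivot s)) }
    ; independent = E∷T-independent
    ; spanning    = λ (z , check∩z≗w) → ∈span-resp {v = E∷T-basis} check∩z≗w
        (∈span-trans {v = check∩ ∘ Basis.vec positions} {w = E∷T-basis}
                     (IsLinear.∈span-homo check∩-linear (Basis.spanning positions {z} tt))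
                     check∩-position∈span)
    }

  D-basis : Basis D RN-D.nullity
  D-basis = Basis-restrict RN-D.kernel-basis D⇒Kernel (Kernel⇒D ∘ Basis.member RN-D.kernel-basis)

  D∩τD-basis : Basis (λ y → D y × τD τ y) RN-∩.nullity
  D∩τD-basis = Basis-restrict RN-∩.kernel-basis ∩⇒Kernel (Kernel⇒∩ ∘ Basis.member RN-∩.kernel-basis)

  Sτ-basis : IsHammingCheck r n H → to zeroV ≡ zeroV → Basis (Sτ τ) (RN-S.nullity ℕ.+ R)
  Sτ-basis hamming τ0 = Basis-restrict preimage Sτ⊆preimage vec∈Sτ
    where
    onto = surjective⇒onto checkS-linear (checkS-surjective hamming)
    preimage = preimage-basis checkS-linear RN-S.kernel-basis ElimT.pivots-independent
                              (proj₁ ∘ onto ∘ T-basis) (proj₂ ∘ onto ∘ T-basis)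
    Sτ⊆preimage : ∀ {z} → Sτ τ z → checkS z ∈span T-basis
    Sτ⊆preimage Sτz = let (a , checkSz≗Ta) = Sτ⇒checkS≗T Sτz in
      ∈span-resp (λ x → sym (checkSz≗Ta x)) (T∈span a)
    vec∈Sτ : ∀ i → Sτ τ (Basis.vec preimage i)
    vec∈Sτ i with splitAt RN-S.nullity i
    ... | inj₁ t = checkS≗T⇒Sτ zeroV (λ x → trans (Basis.member RN-S.kernel-basis t x) (sym (T-zero τ0 x)))
    ... | inj₂ s = checkS≗T⇒Sτ (enum r (ElimT.pivot s)) (proj₂ (onto (T-basis s)))

  checkD-rank+nullity : suc r ℕ.+ RN-D.nullity ≡ Q
  checkD-rank+nullity = begin
    suc r ℕ.+ RN-D.nullity      ≡⟨ cong (ℕ._+ RN-D.nullity) rank≡ ⟨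
    RN-D.rank ℕ.+ RN-D.nullity  ≡⟨ RN-D.rank+nullity ⟩
    Q                           ∎
    where rank≡ = surjective⇒rank≡ checkD-linear checkD-surjective RN-D.image-basis

  check∩-rank+nullity : to zeroV ≡ zeroV → suc R ℕ.+ RN-∩.nullity ≡ Q
  check∩-rank+nullity τ0 = begin
    suc R ℕ.+ RN-∩.nullity      ≡⟨ cong (ℕ._+ RN-∩.nullity) rank≡ ⟨
    RN-∩.rank ℕ.+ RN-∩.nullity  ≡⟨ RN-∩.rank+nullity ⟩
    Q                           ∎
    where rank≡ = Basis-unique RN-∩.image-basis (check∩-image-basis τ0) (id , id)

  checkS-rank+nullity : IsHammingCheck r n H → (r ℕ.+ suc r) ℕ.+ RN-S.nullity ≡ n ℕ.+ Q
  checkS-rank+nullity hamming = begin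
    (r ℕ.+ suc r) ℕ.+ RN-S.nullity  ≡⟨ cong (ℕ._+ RN-S.nullity) rank≡ ⟨
    RN-S.rank ℕ.+ RN-S.nullity      ≡⟨ RN-S.rank+nullity ⟩
    n ℕ.+ Q                         ∎
    where rank≡ = surjective⇒rank≡ checkS-linear (checkS-surjective hamming) RN-S.image-basis

open import Data.Nat using (_+_; _∸_; _^_)
open ≡-Reasoning

dimension-count : ∀ {r n Q R l κD κ∩ κS} →
                  suc r + κD ≡ Q → suc R + κ∩ ≡ Q → (r + suc r) + κS ≡ n + Q → κD ≡ κ∩ + l →
                  κS + R ≡ n + Q ∸ suc r + l
dimension-count {r} {n} {Q} {R} {l} {κD} {κ∩} {κS} D-eq ∩-eq S-eq refl = begin
  κS + R             ≡⟨ cong (κS +_) R≡r+l ⟩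
  κS + (r + l)       ≡⟨ ℕ.+-assoc κS r l ⟨
  κS + r + l         ≡⟨ cong (_+ l) (ℕ.+-comm κS r) ⟩
  r + κS + l         ≡⟨ cong (_+ l) n+Q∸suc-r≡r+κS ⟨
  n + Q ∸ suc r + l  ∎
  where
  R≡r+l : R ≡ r + l
  R≡r+l = ℕ.+-cancelʳ-≡ κ∩ R (r + l) (ℕ.suc-injective (begin
    suc R + κ∩        ≡⟨ ∩-eq ⟩
    Q                 ≡⟨ D-eq ⟨
    suc r + (κ∩ + l)  ≡⟨ cong (suc r +_) (ℕ.+-comm κ∩ l) ⟩
    suc r + (l + κ∩)  ≡⟨ cong suc (ℕ.+-assoc r l κ∩) ⟨
    suc (r + l + κ∩)  ∎))
  n+Q∸suc-r≡r+κS : n + Q ∸ suc r ≡ r + κS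
  n+Q∸suc-r≡r+κS = begin
    n + Q ∸ suc r             ≡⟨ cong (_∸ suc r) S-eq ⟨
    r + suc r + κS ∸ suc r    ≡⟨ cong (_∸ suc r) (ℕ.+-assoc r (suc r) κS) ⟩
    r + (suc r + κS) ∸ suc r  ≡⟨ cong (λ m → r + m ∸ suc r) (ℕ.+-comm (suc r) κS) ⟩
    r + (κS + suc r) ∸ suc r  ≡⟨ cong (_∸ suc r) (ℕ.+-assoc r κS (suc r)) ⟨
    r + κS + suc r ∸ suc r    ≡⟨ ℕ.m+n∸n≡m (r + κS) (suc r) ⟩
    r + κS                    ∎

theorem3 : (q : ℕ) (F : FiniteField q) (r : ℕ) → 1 ≤ r →
    (n : ℕ) (H : Fin n → LinAlg.Vecr F r) → LinAlg.IsHammingCheck F r n H →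
    (τ : LinAlg.Vecr F r ↔ LinAlg.Vecr F r) →
    Inverse.to τ (LinAlg.zeroV F) ≡ LinAlg.zeroV F →
    (l : ℕ) → LinAlg.Codes.Distension F r n H τ l →
    LinAlg.HasRank F (LinAlg.Codes.Sτ F r n H τ) (n + q ^ r ∸ suc r + l)
theorem3 q F r _ n H hamming τ τ0 l (d , d′ , rank-D , rank-D∩τD , d≡d′+l) =
  subst (LinAlg.HasRank F (LinAlg.Codes.Sτ F r n H τ))
        (dimension-count checkD-rank+nullity (check∩-rank+nullity τ0) (checkS-rank+nullity hamming) κD≡κ∩+l)
        (Basis⇒HasRank (Sτ-basis hamming τ0))
  where
  open LinearAlgebra F using (Basis⇒HasRank; HasRank-unique)
  open Construction F H τ
  κD≡κ∩+l : RN-D.nullity ≡ RN-∩.nullity + l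
  κD≡κ∩+l = begin
    RN-D.nullity      ≡⟨ HasRank-unique rank-D D-basis ⟨
    d                 ≡⟨ d≡d′+l ⟩
    d′ + l            ≡⟨ cong (_+ l) (HasRank-unique rank-D∩τD D∩τD-basis) ⟩
    RN-∩.nullity + l  ∎
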